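{- Let $P_k$ be the path on $k$ vertices. For $k\ge3$, $n(P_k)=(k+1)\cdot 2^{k-3}$.
   Context: A word $w$ over the alphabet $V$ word-represents a graph $G=(V,E)$ if $w$ contains every letter of $V$ at least once and for all distinct $x,y\in V$, $xy\in E$ if and only if $x$ and $y$ alternate in $w$ (the subword of $w$ consisting only of occurrences of $x$ and $y$ has no two equal consecutive letters). $\ell(G)$ is the minimum length of a word that word-represents $G$, and $n(G)$ is the number of words of length $\ell(G)$ that word-represent $G$. -}

module Defs where

open import Data.Nat using (ℕ; suc; _+_; _*_; _≤_)
open import Data.Bool using (Bool; true; false; _∧_; _∨_; not; T; if_then_else_)
open import Data.Fin using (Fin; toℕ; _≟_)
open import Data.List using (List; []; _∷_; allFin; length)
open import Data.Vec using (Vec; toList)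
open import Data.Product using (Σ; _×_; ∃)
open import Relation.Nullary.Decidable using (⌊_⌋)
open import Relation.Binary.PropositionalEquality using (_≡_)
open import Function.Bundles using (_↔_)

Graph : ℕ → Set
Graph n = Fin n → Fin n → Bool

_==_ : ∀ {n} → Fin n → Fin n → Bool
x == y = ⌊ x ≟ y ⌋

path : (k : ℕ) → Graph k
path k x y = ⌊ suc (toℕ x) Data.Nat.≟ toℕ y ⌋ ∨ ⌊ suc (toℕ y) Data.Nat.≟ toℕ x ⌋

filterᵇ : ∀ {A : Set} → (A → Bool) → List A → List A
filterᵇ p []       = []
filterᵇ p (a ∷ as) = if p a then a ∷ filterᵇ p as else filterᵇ p as

allᵇ : ∀ {A : Set} → (A → Bool) → List A → Bool
allᵇ p []       = true
allᵇ p (a ∷ as) = p a ∧ allᵇ p as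

anyᵇ : ∀ {A : Set} → (A → Bool) → List A → Bool
anyᵇ p []       = false
anyᵇ p (a ∷ as) = p a ∨ anyᵇ p as

_⇔ᵇ_ : Bool → Bool → Bool
true  ⇔ᵇ b = b
false ⇔ᵇ b = not b

noRepeat : ∀ {n} → List (Fin n) → Bool
noRepeat []           = true
noRepeat (a ∷ [])     = true
noRepeat (a ∷ b ∷ as) = not (a == b) ∧ noRepeat (b ∷ as)

alternate : ∀ {n} → List (Fin n) → Fin n → Fin n → Bool
alternate w x y = noRepeat (filterᵇ (λ z → (z == x) ∨ (z == y)) w)

representsᵇ : ∀ {n} → Graph n → List (Fin n) → Bool
representsᵇ {n} G w =
  allᵇ (λ v → anyᵇ (λ z → z == v) w) (allFin n)
  ∧ allᵇ (λ x → allᵇ (λ y → (x == y) ∨ (G x y ⇔ᵇ alternate w x y)) (allFin n)) (allFin n)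

Represents : ∀ {n} → Graph n → List (Fin n) → Set
Represents G w = T (representsᵇ G w)

IsMinRepLength : ∀ {n} → Graph n → ℕ → Set
IsMinRepLength {n} G m =
  Σ (Vec (Fin n) m) (λ w → Represents G (toList w))
  × (∀ (w : List (Fin n)) → Represents G w → m ≤ length w)

IsNumMinWords : ∀ {n} → Graph n → ℕ → Set
IsNumMinWords {n} G N =
  ∃ λ m → IsMinRepLength G m × (Fin N ↔ Σ (Vec (Fin n) m) (λ w → Represents G (toList w)))

module Submission where

-- Take the path on the letters 0,…,m (so k = m+1).  Letters occurring once in a representant
--   pairwise alternate, hence are adjacent; so at most two letters are single
--   and |w| = Σᵥ count v w ≥ 2(m+1) − 2.  At length 2m ("minimal" words) every
--   letter occurs at most twice and at least two letters are single.
-- • Wrapping (module Wrap).  If α d β represents the path with top letter d,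
--   then α e d e β represents the path extended by a new top letter e.
-- • Tightness (module Tightness).  Conversely, if e occurs twice in a minimal
--   word, the factor between the two e's is exactly d.
-- • Step bijection (module Step).  As d occurs once or twice, deleting e gives
--     {e twice}_{m+1} ≅ {d once}_m ⊎ {d twice}_m ⊎ {d twice}_m
--   (the wrapped d is the only, the first or the last one), compatibly with any
--   property of the word with e deleted.
-- • Reversal i ↦ m − i maps {top once} onto {0 once}; for m ≥ 2 the letters 0
--   and m are not adjacent, hence never both single.
-- • Counting (record Sizes).  The sizes of {top once} and {top twice}, with and
--   without the condition "0 occurs once", obey a linear recurrence starting
--   from P₂ (words 01 and 10); its solution gives the theorem.

open import Defs
open import Data.Nat using (ℕ; zero; suc; _+_; _*_; _^_; _∸_; _≤_; _<_; z≤n; s≤s; _≡ᵇ_)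
open import Data.Nat.Properties hiding (_≟_)
import Data.Nat as ℕ
open import Data.Bool using (Bool; true; false; _∧_; _∨_; not; T; if_then_else_)
open import Data.Bool.Properties using (T-irrelevant; T-≡; T-∧; ∨-comm; ∧-comm; ∧-identityʳ; ∧-conicalˡ; ∧-conicalʳ; ¬-not)
open import Data.Fin using (Fin; zero; suc; toℕ; fromℕ; inject₁; opposite; fromℕ<; _≟_)
import Data.Fin.Properties as FP
open import Data.Fin.Relation.Unary.Top using (view; ‵fromℕ; ‵inject₁; view-fromℕ; view-inject₁)
open import Data.List using (List; []; _∷_; _++_; length; map; allFin; replicate)
open import Data.List.Properties using (length-++; length-map; ++-assoc)
open import Data.List.Membership.Propositional using (_∈_)
open import Data.List.Membership.Propositional.Properties using (∈-allFin)
open import Data.List.Relation.Unary.Any using (here; there)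
open import Data.Vec using (Vec; toList) renaming ([] to []v; _∷_ to _∷v_)
open import Data.Vec.Properties using (length-toList)
open import Data.Product hiding (map)
open import Data.Product.Properties using (Σ-≡,≡→≡)
open import Data.Sum using (_⊎_; inj₁; inj₂; [_,_]′)
open import Data.Sum.Function.Propositional using (_⊎-cong_)
open import Data.Empty using (⊥-elim)
open import Data.Unit using (tt)
open import Relation.Nullary using (¬_; yes; no; isYes)
open import Relation.Nullary.Decidable using (_×-dec_; ¬?)
open import Relation.Binary.PropositionalEquality
open import Function using (_∘_; case_of_; _↔_; mk↔ₛ′; Equivalence; Inverse)
open import Function.Properties.Inverse using (↔-refl; ↔-sym; ↔-trans)
open import Data.Nat.Tactic.RingSolver using (solve-∀)


==-refl : ∀ {n} (x : Fin n) → (x == x) ≡ true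
==-refl x with x ≟ x
... | yes _ = refl
... | no x≢x = ⊥-elim (x≢x refl)

≢⇒==-false : ∀ {n} {x y : Fin n} → x ≢ y → (x == y) ≡ false
≢⇒==-false {x = x} {y} x≢y with x ≟ y
... | yes x≡y = ⊥-elim (x≢y x≡y)
... | no _ = refl

suc-== : ∀ {n} (a b : Fin n) → (Fin.suc a == Fin.suc b) ≡ (a == b)
suc-== a b with a ≟ b
... | yes refl = refl
... | no _ = refl

count : ∀ {n} → Fin n → List (Fin n) → ℕ
count v [] = 0
count v (x ∷ xs) = if x == v then suc (count v xs) else count v xs

indicator : Bool → ℕ
indicator true = 1
indicator false = 0

count-∷ : ∀ {n} (x v : Fin n) w → count v (x ∷ w) ≡ indicator (x == v) + count v w
count-∷ x v w with x ≟ v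
... | yes _ = refl
... | no _ = refl

count-here : ∀ {n} (v : Fin n) w → count v (v ∷ w) ≡ suc (count v w)
count-here v w rewrite count-∷ v v w | ==-refl v = refl

count-there : ∀ {n} {x v : Fin n} w → x ≢ v → count v (x ∷ w) ≡ count v w
count-there {x = x} {v} w x≢v rewrite count-∷ x v w | ≢⇒==-false x≢v = refl

count-++ : ∀ {n} (v : Fin n) u w → count v (u ++ w) ≡ count v u + count v w
count-++ v [] w = refl
count-++ v (x ∷ u) w rewrite count-∷ x v (u ++ w) | count-∷ x v u | count-++ v u w =
  sym (+-assoc (indicator (x == v)) (count v u) (count v w))

count-around : ∀ {n} (y x : Fin n) α β → y ≢ x → count y (α ++ x ∷ β) ≡ count y α + count y β
count-around y x α β y≢x = trans (count-++ y α (x ∷ β)) (cong (count y α +_) (count-there β (y≢x ∘ sym)))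

count-around₂ : ∀ {n} (y x : Fin n) α γ β → y ≢ x →
  count y (α ++ x ∷ γ ++ x ∷ β) ≡ count y α + (count y γ + count y β)
count-around₂ y x α γ β y≢x =
  trans (count-around y x α (γ ++ x ∷ β) y≢x) (cong (count y α +_) (count-around y x γ β y≢x))

OnceSplit : ∀ {n} → Fin n → List (Fin n) → Set
OnceSplit {n} v w = Σ[ α ∈ List (Fin n) ] Σ[ β ∈ List (Fin n) ] w ≡ α ++ v ∷ β × count v α ≡ 0 × count v β ≡ 0

TwiceSplit : ∀ {n} → Fin n → List (Fin n) → Set
TwiceSplit {n} v w = Σ[ α ∈ List (Fin n) ] Σ[ γ ∈ List (Fin n) ] Σ[ β ∈ List (Fin n) ]
  w ≡ α ++ v ∷ γ ++ v ∷ β × count v α ≡ 0 × count v γ ≡ 0 × count v β ≡ 0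

split-once : ∀ {n} (v : Fin n) w → count v w ≡ 1 → OnceSplit v w
split-once v [] ()
split-once v (x ∷ w) h with x ≟ v
... | yes refl = [] , w , refl , refl , suc-injective h
... | no x≢v with split-once v w h
...   | α , β , w≡ , cα , cβ = x ∷ α , β , cong (x ∷_) w≡ , trans (count-there α x≢v) cα , cβ

split-twice : ∀ {n} (v : Fin n) w → count v w ≡ 2 → TwiceSplit v w
split-twice v [] ()
split-twice v (x ∷ w) h with x ≟ v
... | yes refl with split-once x w (suc-injective h)
...   | γ , β , w≡ , cγ , cβ = [] , γ , β , cong (x ∷_) w≡ , refl , cγ , cβ
split-twice v (x ∷ w) h | no x≢v with split-twice v w h
... | α , γ , β , w≡ , cα , cγ , cβ = x ∷ α , γ , β , cong (x ∷_) w≡ , trans (count-there α x≢v) cα , cγ , cβ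

no-letters⇒[] : ∀ {n} (γ : List (Fin n)) → (∀ y → count y γ ≡ 0) → γ ≡ []
no-letters⇒[] [] _ = refl
no-letters⇒[] (x ∷ γ) h = case trans (sym (count-here x γ)) (h x) of λ ()

only-once⇒singleton : ∀ {n} (d : Fin n) γ → (∀ y → y ≢ d → count y γ ≡ 0) → count d γ ≡ 1 → γ ≡ d ∷ []
only-once⇒singleton d [] _ ()
only-once⇒singleton d (x ∷ γ) h c with x ≟ d
... | no x≢d = case trans (sym (count-here x γ)) (h x x≢d) of λ ()
... | yes refl = cong (x ∷_) (no-letters⇒[] γ absent)
  where
  absent : ∀ y → count y γ ≡ 0
  absent y with y ≟ x
  ... | yes refl = suc-injective c
  ... | no y≢x = trans (sym (count-there γ (y≢x ∘ sym))) (h y y≢x)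

onto : ∀ {n} → Fin n → Fin n → List (Fin n) → List (Fin n)
onto x y = filterᵇ (λ z → (z == x) ∨ (z == y))

filterᵇ-++ : ∀ {A : Set} (p : A → Bool) (u w : List A) → filterᵇ p (u ++ w) ≡ filterᵇ p u ++ filterᵇ p w
filterᵇ-++ p [] w = refl
filterᵇ-++ p (x ∷ u) w with p x
... | true = cong (x ∷_) (filterᵇ-++ p u w)
... | false = filterᵇ-++ p u w

filterᵇ-cong : ∀ {A : Set} {p q : A → Bool} → (∀ z → p z ≡ q z) → ∀ w → filterᵇ p w ≡ filterᵇ q w
filterᵇ-cong p≗q [] = refl
filterᵇ-cong {q = q} p≗q (x ∷ w) rewrite p≗q x with q x
... | true = cong (x ∷_) (filterᵇ-cong p≗q w)
... | false = filterᵇ-cong p≗q w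

alternate-sym : ∀ {n} (w : List (Fin n)) x y → alternate w x y ≡ alternate w y x
alternate-sym w x y = cong noRepeat (filterᵇ-cong (λ z → ∨-comm (z == x) (z == y)) w)

onto-absent : ∀ {n} (x y : Fin n) w → count x w ≡ 0 → onto x y w ≡ replicate (count y w) y
onto-absent x y [] _ = refl
onto-absent x y (z ∷ w) h with z ≟ x
onto-absent x y (z ∷ w) () | yes refl
... | no _ with z ≟ y
...   | yes refl = cong (z ∷_) (onto-absent x z w h)
...   | no _ = onto-absent x y w h

onto-head : ∀ {n} (x y : Fin n) w → onto x y (x ∷ w) ≡ x ∷ onto x y w
onto-head x y w rewrite ==-refl x = refl

shape : ∀ {n} (x y : Fin n) (a c b : ℕ) → List (Fin n)
shape x y a c b = replicate a y ++ x ∷ replicate c y ++ x ∷ replicate b y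

onto-once : ∀ {n} (x y : Fin n) α β → count x α ≡ 0 → count x β ≡ 0 →
  onto x y (α ++ x ∷ β) ≡ replicate (count y α) y ++ x ∷ replicate (count y β) y
onto-once x y α β hα hβ = begin
  onto x y (α ++ x ∷ β)                  ≡⟨ filterᵇ-++ _ α (x ∷ β) ⟩
  onto x y α ++ onto x y (x ∷ β)          ≡⟨ cong₂ _++_ (onto-absent x y α hα) (onto-head x y β) ⟩
  replicate (count y α) y ++ x ∷ onto x y β ≡⟨ cong (λ l → replicate (count y α) y ++ x ∷ l) (onto-absent x y β hβ) ⟩
  replicate (count y α) y ++ x ∷ replicate (count y β) y ∎
  where open ≡-Reasoning

onto-twice : ∀ {n} (x y : Fin n) α γ β → count x α ≡ 0 → count x γ ≡ 0 → count x β ≡ 0 →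
  onto x y (α ++ x ∷ γ ++ x ∷ β) ≡ shape x y (count y α) (count y γ) (count y β)
onto-twice x y α γ β hα hγ hβ = begin
  onto x y (α ++ x ∷ γ ++ x ∷ β)           ≡⟨ filterᵇ-++ _ α (x ∷ γ ++ x ∷ β) ⟩
  onto x y α ++ onto x y (x ∷ γ ++ x ∷ β)   ≡⟨ cong₂ _++_ (onto-absent x y α hα) (onto-head x y (γ ++ x ∷ β)) ⟩
  replicate (count y α) y ++ x ∷ onto x y (γ ++ x ∷ β)
    ≡⟨ cong (λ l → replicate (count y α) y ++ x ∷ l) (onto-once x y γ β hγ hβ) ⟩
  shape x y (count y α) (count y γ) (count y β) ∎
  where open ≡-Reasoning

noRepeat-tail : ∀ {n} (a : Fin n) w → noRepeat (a ∷ w) ≡ true → noRepeat w ≡ true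
noRepeat-tail a [] _ = refl
noRepeat-tail a (b ∷ w) h = ∧-conicalʳ (not (a == b)) _ h

noRepeat-suffix : ∀ {n} (u w : List (Fin n)) → noRepeat (u ++ w) ≡ true → noRepeat w ≡ true
noRepeat-suffix [] w h = h
noRepeat-suffix (x ∷ u) w h = noRepeat-suffix u w (noRepeat-tail x (u ++ w) h)

shape-alternates⇒one-between : ∀ {n} {x y : Fin n} a c b → noRepeat (shape x y a c b) ≡ true → c ≡ 1
shape-alternates⇒one-between {x = x} {y} a c b h = middle c (noRepeat-suffix (replicate a y) _ h)
  where
  middle : ∀ c → noRepeat (x ∷ replicate c y ++ x ∷ replicate b y) ≡ true → c ≡ 1
  middle zero h rewrite ==-refl x = case h of λ ()
  middle (suc zero) _ = refl
  middle (suc (suc c)) h rewrite ==-refl y = case ∧-conicalʳ (not (x == y)) _ h of λ ()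

shape-alternates : ∀ {n} {x y : Fin n} → x ≢ y → ∀ a b → a ≤ 1 → b ≤ 1 → noRepeat (shape x y a 1 b) ≡ true
shape-alternates {x = x} {y} x≢y a b a≤1 b≤1 with n≤1⇒n≡0∨n≡1 a≤1 | n≤1⇒n≡0∨n≡1 b≤1
... | inj₁ refl | inj₁ refl rewrite ≢⇒==-false x≢y | ≢⇒==-false (x≢y ∘ sym) = refl
... | inj₁ refl | inj₂ refl rewrite ≢⇒==-false x≢y | ≢⇒==-false (x≢y ∘ sym) = refl
... | inj₂ refl | inj₁ refl rewrite ≢⇒==-false x≢y | ≢⇒==-false (x≢y ∘ sym) = refl
... | inj₂ refl | inj₂ refl rewrite ≢⇒==-false x≢y | ≢⇒==-false (x≢y ∘ sym) = refl

singles-alternate : ∀ {n} (w : List (Fin n)) x y → x ≢ y → count x w ≡ 1 → count y w ≡ 1 → alternate w x y ≡ true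
singles-alternate w x y x≢y cx cy with split-once x w cx
... | α , β , refl , hα , hβ rewrite onto-once x y α β hα hβ =
  one-y (count y α) (count y β) (trans (sym (count-around y x α β (x≢y ∘ sym))) cy)
  where
  one-y : ∀ a b → a + b ≡ 1 → noRepeat (replicate a y ++ x ∷ replicate b y) ≡ true
  one-y zero (suc zero) _ rewrite ≢⇒==-false x≢y = refl
  one-y (suc zero) zero _ rewrite ≢⇒==-false (x≢y ∘ sym) = refl
  one-y zero zero ()
  one-y zero (suc (suc b)) ()
  one-y (suc zero) (suc b) ()
  one-y (suc (suc a)) b ()

record Repr {n} (G : Graph n) (w : List (Fin n)) : Set where
  field
    occurs : ∀ v → 1 ≤ count v w
    edges : ∀ x y → x ≢ y → G x y ≡ alternate w x y
open Repr public

any-occurs⇒count : ∀ {n} (v : Fin n) w → anyᵇ (λ z → z == v) w ≡ true → 1 ≤ count v w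
any-occurs⇒count v [] ()
any-occurs⇒count v (x ∷ w) h with x ≟ v
... | yes _ = s≤s z≤n
... | no _ = any-occurs⇒count v w h

count⇒any-occurs : ∀ {n} (v : Fin n) w → 1 ≤ count v w → anyᵇ (λ z → z == v) w ≡ true
count⇒any-occurs v [] ()
count⇒any-occurs v (x ∷ w) h with x ≟ v
... | yes _ = refl
... | no _ = count⇒any-occurs v w h

allᵇ-elim : ∀ {A : Set} (p : A → Bool) xs → allᵇ p xs ≡ true → ∀ {x} → x ∈ xs → p x ≡ true
allᵇ-elim p (y ∷ xs) h (here refl) = ∧-conicalˡ (p y) _ h
allᵇ-elim p (y ∷ xs) h (there x∈xs) = allᵇ-elim p xs (∧-conicalʳ (p y) _ h) x∈xs

allᵇ-intro : ∀ {A : Set} (p : A → Bool) xs → (∀ x → p x ≡ true) → allᵇ p xs ≡ true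
allᵇ-intro p [] _ = refl
allᵇ-intro p (x ∷ xs) h rewrite h x = allᵇ-intro p xs h

⇔ᵇ-sound : ∀ a b → (a ⇔ᵇ b) ≡ true → a ≡ b
⇔ᵇ-sound true true _ = refl
⇔ᵇ-sound false false _ = refl

⇔ᵇ-refl : ∀ a → (a ⇔ᵇ a) ≡ true
⇔ᵇ-refl true = refl
⇔ᵇ-refl false = refl

Represents⇒Repr : ∀ {n} (G : Graph n) w → Represents G w → Repr G w
Represents⇒Repr {n} G w r = record { occurs = occ ; edges = edge }
  where
  occurring : Bool
  occurring = allᵇ (λ v → anyᵇ (λ z → z == v) w) (allFin n)
  both : representsᵇ G w ≡ true
  both = Equivalence.to T-≡ r
  occ : ∀ v → 1 ≤ count v w
  occ v = any-occurs⇒count v w (allᵇ-elim _ (allFin n) (∧-conicalˡ occurring _ both) (∈-allFin v))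
  edge : ∀ x y → x ≢ y → G x y ≡ alternate w x y
  edge x y x≢y with allᵇ-elim _ (allFin n) (allᵇ-elim _ (allFin n) (∧-conicalʳ occurring _ both) (∈-allFin x)) (∈-allFin y)
  ... | h rewrite ≢⇒==-false x≢y = ⇔ᵇ-sound (G x y) _ h

Repr⇒Represents : ∀ {n} (G : Graph n) w → Repr G w → Represents G w
Repr⇒Represents {n} G w r = Equivalence.from T-≡
  (cong₂ _∧_ (allᵇ-intro _ (allFin n) (λ v → count⇒any-occurs v w (occurs r v)))
             (allᵇ-intro _ (allFin n) (λ x → allᵇ-intro _ (allFin n) (pair x))))
  where
  pair : ∀ x y → (x == y) ∨ (G x y ⇔ᵇ alternate w x y) ≡ true
  pair x y with x ≟ y
  ... | yes _ = refl
  ... | no x≢y rewrite edges r x y x≢y = ⇔ᵇ-refl (alternate w x y)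

sumFin : ∀ {n} → (Fin n → ℕ) → ℕ
sumFin {zero} f = 0
sumFin {suc n} f = f zero + sumFin (f ∘ suc)

sumFin-cong : ∀ {n} {f g : Fin n → ℕ} → (∀ v → f v ≡ g v) → sumFin f ≡ sumFin g
sumFin-cong {zero} _ = refl
sumFin-cong {suc n} f≗g = cong₂ _+_ (f≗g zero) (sumFin-cong (f≗g ∘ suc))

sumFin-const : ∀ n c → sumFin {n} (λ _ → c) ≡ n * c
sumFin-const zero c = refl
sumFin-const (suc n) c = cong (c +_) (sumFin-const n c)

sumFin-zero : ∀ n → sumFin {n} (λ _ → 0) ≡ 0
sumFin-zero n = trans (sumFin-const n 0) (*-zeroʳ n)

sumFin-+ : ∀ {n} (f g : Fin n → ℕ) → sumFin (λ v → f v + g v) ≡ sumFin f + sumFin g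
sumFin-+ {zero} f g = refl
sumFin-+ {suc n} f g =
  trans (cong (f zero + g zero +_) (sumFin-+ (f ∘ suc) (g ∘ suc))) (interchange (f zero) (g zero) _ _)
  where
  interchange : ∀ a b c d → a + b + (c + d) ≡ a + c + (b + d)
  interchange = solve-∀

sumFin-mono : ∀ {n} {f g : Fin n → ℕ} → (∀ v → f v ≤ g v) → sumFin f ≤ sumFin g
sumFin-mono {zero} _ = z≤n
sumFin-mono {suc n} f≤g = +-mono-≤ (f≤g zero) (sumFin-mono (f≤g ∘ suc))

sumFin-tight : ∀ {n} {f g : Fin n → ℕ} → (∀ v → f v ≤ g v) → sumFin g ≤ sumFin f → ∀ v → g v ≤ f v
sumFin-tight {suc n} {f} {g} f≤g Σg≤Σf zero = +-cancelʳ-≤ (sumFin (f ∘ suc)) (g zero) (f zero)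
  (≤-trans (+-monoʳ-≤ (g zero) (sumFin-mono (f≤g ∘ suc))) Σg≤Σf)
sumFin-tight {suc n} {f} {g} f≤g Σg≤Σf (suc v) = sumFin-tight (f≤g ∘ suc)
  (+-cancelˡ-≤ (g zero) _ _ (≤-trans Σg≤Σf (+-monoˡ-≤ _ (f≤g zero)))) v

sumFin-== : ∀ {n} (x : Fin n) → sumFin (λ v → indicator (x == v)) ≡ 1
sumFin-== {suc n} zero = cong suc (sumFin-zero n)
sumFin-== {suc n} (suc x) = trans (sumFin-cong (λ v → cong indicator (suc-== x v))) (sumFin-== x)

≡ᵇ-refl : ∀ t → (t ≡ᵇ t) ≡ true
≡ᵇ-refl t = Equivalence.to T-≡ (≡⇒≡ᵇ t t refl)

sumFin-index : ∀ {n} t → sumFin {n} (λ v → indicator (toℕ v ≡ᵇ t)) ≤ 1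
sumFin-index {zero} t = z≤n
sumFin-index {suc n} zero = s≤s (≤-reflexive (sumFin-zero n))
sumFin-index {suc n} (suc t) = sumFin-index {n} t

length≡sumFin-count : ∀ {n} (w : List (Fin n)) → length w ≡ sumFin (λ v → count v w)
length≡sumFin-count {n} [] = sym (sumFin-zero n)
length≡sumFin-count {n} (x ∷ w) = sym (begin
  sumFin (λ v → count v (x ∷ w))                            ≡⟨ sumFin-cong (λ v → count-∷ x v w) ⟩
  sumFin (λ v → indicator (x == v) + count v w)             ≡⟨ sumFin-+ (λ v → indicator (x == v)) (λ v → count v w) ⟩
  sumFin (λ v → indicator (x == v)) + sumFin (λ v → count v w) ≡⟨ cong₂ _+_ (sumFin-== x) (sym (length≡sumFin-count w)) ⟩
  suc (length w) ∎)
  where open ≡-Reasoning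

Adj : ∀ {k} → Fin k → Fin k → Set
Adj x y = suc (toℕ x) ≡ toℕ y ⊎ suc (toℕ y) ≡ toℕ x

path⇒Adj : ∀ {k} (x y : Fin k) → path k x y ≡ true → Adj x y
path⇒Adj x y h with suc (toℕ x) ℕ.≟ toℕ y
... | yes e = inj₁ e
... | no _ with suc (toℕ y) ℕ.≟ toℕ x
...   | yes e = inj₂ e
path⇒Adj x y () | no _ | no _

Adj⇒path : ∀ {k} (x y : Fin k) → Adj x y → path k x y ≡ true
Adj⇒path x y a with suc (toℕ x) ℕ.≟ toℕ y
... | yes _ = refl
... | no ¬xy with suc (toℕ y) ℕ.≟ toℕ x
...   | yes _ = refl
...   | no ¬yx = ⊥-elim ([ ¬xy , ¬yx ]′ a)

¬Adj⇒¬path : ∀ {k} (x y : Fin k) → ¬ Adj x y → path k x y ≡ false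
¬Adj⇒¬path x y ¬a with suc (toℕ x) ℕ.≟ toℕ y
... | yes e = ⊥-elim (¬a (inj₁ e))
... | no _ with suc (toℕ y) ℕ.≟ toℕ x
...   | yes e = ⊥-elim (¬a (inj₂ e))
...   | no _ = refl

path-sym : ∀ k (x y : Fin k) → path k x y ≡ path k y x
path-sym k x y = ∨-comm (isYes (suc (toℕ x) ℕ.≟ toℕ y)) _

-- Lower bound |w| ≥ 2m for every representant w of the path on 0,…,m, and the
-- consequences of equality.  The key point: single letters are pairwise adjacent.

module Singles {m : ℕ} (w : List (Fin (suc m))) (r : Repr (path (suc m)) w) where

  singles-adjacent : ∀ x y → x ≢ y → count x w ≡ 1 → count y w ≡ 1 → Adj x y
  singles-adjacent x y x≢y cx cy = path⇒Adj x y (trans (edges r x y x≢y) (singles-alternate w x y x≢y cx cy))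

  single : Fin (suc m) → ℕ
  single v = indicator (count v w ≡ᵇ 1)

  #singles : ℕ
  #singles = sumFin single

  count+single≥2 : ∀ v → 2 ≤ count v w + single v
  count+single≥2 v with count v w | occurs r v
  ... | suc zero | _ = s≤s (s≤s z≤n)
  ... | suc (suc _) | _ = s≤s (s≤s z≤n)

  singles-consecutive : Σ[ t ∈ ℕ ] (∀ v → count v w ≡ 1 → toℕ v ≡ t ⊎ toℕ v ≡ suc t)
  singles-consecutive with FP.any? (λ v → count v w ℕ.≟ 1)
  ... | no none = 0 , λ v h → ⊥-elim (none (v , h))
  ... | yes (i , ci) with FP.any? (λ j → count j w ℕ.≟ 1 ×-dec suc (toℕ j) ℕ.≟ toℕ i)
  ...   | yes (j , cj , j+1≡i) = toℕ j , below
    where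
    below : ∀ v → count v w ≡ 1 → toℕ v ≡ toℕ j ⊎ toℕ v ≡ suc (toℕ j)
    below v cv with v ≟ j | v ≟ i
    ... | yes refl | _ = inj₁ refl
    ... | no _ | yes refl = inj₂ (sym j+1≡i)
    ... | no v≢j | no v≢i with singles-adjacent v i v≢i cv ci
    ...   | inj₁ v+1≡i = ⊥-elim (v≢j (FP.toℕ-injective (suc-injective (trans v+1≡i (sym j+1≡i)))))
    ...   | inj₂ i+1≡v with singles-adjacent v j v≢j cv cj
    ...     | inj₁ v+1≡j = ⊥-elim (m≢1+n+m (toℕ j) (sym (trans (cong (λ z → suc (suc z)) j+1≡i) (trans (cong suc i+1≡v) v+1≡j))))
    ...     | inj₂ j+1≡v = ⊥-elim (v≢i (FP.toℕ-injective (trans (sym j+1≡v) j+1≡i)))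
  ...   | no no-below = toℕ i , above
    where
    above : ∀ v → count v w ≡ 1 → toℕ v ≡ toℕ i ⊎ toℕ v ≡ suc (toℕ i)
    above v cv with v ≟ i
    ... | yes refl = inj₁ refl
    ... | no v≢i with singles-adjacent v i v≢i cv ci
    ...   | inj₁ v+1≡i = ⊥-elim (no-below (v , cv , v+1≡i))
    ...   | inj₂ i+1≡v = inj₂ (sym i+1≡v)

  #singles≤2 : #singles ≤ 2
  #singles≤2 = begin
    sumFin single                                   ≤⟨ sumFin-mono at-t-or-t+1 ⟩
    sumFin (λ v → index t v + index (suc t) v)     ≡⟨ sumFin-+ (index t) (index (suc t)) ⟩
    sumFin (index t) + sumFin (index (suc t))      ≤⟨ +-mono-≤ (sumFin-index {suc m} t) (sumFin-index {suc m} (suc t)) ⟩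
    2 ∎
    where
    open ≤-Reasoning
    t : ℕ
    t = proj₁ singles-consecutive
    index : ℕ → Fin (suc m) → ℕ
    index s v = indicator (toℕ v ≡ᵇ s)
    at-t-or-t+1 : ∀ v → single v ≤ index t v + index (suc t) v
    at-t-or-t+1 v with count v w ≡ᵇ 1 in c
    ... | false = z≤n
    ... | true with proj₂ singles-consecutive v (≡ᵇ⇒≡ _ _ (Equivalence.from T-≡ c))
    ...   | inj₁ v≡t rewrite v≡t | ≡ᵇ-refl t = s≤s z≤n
    ...   | inj₂ v≡t+1 rewrite v≡t+1 | ≡ᵇ-refl t = m≤n+m 1 (indicator (suc t ≡ᵇ t))

  2[m+1]≤length+#singles : suc m * 2 ≤ length w + #singles
  2[m+1]≤length+#singles = begin
    suc m * 2                                ≡⟨ sumFin-const (suc m) 2 ⟨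
    sumFin {suc m} (λ _ → 2)                 ≤⟨ sumFin-mono count+single≥2 ⟩
    sumFin (λ v → count v w + single v)      ≡⟨ sumFin-+ (λ v → count v w) single ⟩
    sumFin (λ v → count v w) + #singles      ≡⟨ cong (_+ #singles) (length≡sumFin-count w) ⟨
    length w + #singles ∎
    where open ≤-Reasoning

  2[m+1]≡2m+2 : suc m * 2 ≡ m + m + 2
  2[m+1]≡2m+2 = lemma m
    where
    lemma : ∀ m → suc m * 2 ≡ m + m + 2
    lemma = solve-∀

  length≥2m : m + m ≤ length w
  length≥2m = +-cancelʳ-≤ 2 (m + m) (length w) (begin
    m + m + 2           ≡⟨ 2[m+1]≡2m+2 ⟨
    suc m * 2           ≤⟨ 2[m+1]≤length+#singles ⟩
    length w + #singles ≤⟨ +-monoʳ-≤ (length w) #singles≤2 ⟩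
    length w + 2 ∎)
    where open ≤-Reasoning

  module Minimal (short : length w ≤ m + m) where

    count≤2 : ∀ v → count v w ≤ 2
    count≤2 v = ≤-trans (m≤m+n (count v w) (single v)) (sumFin-tight count+single≥2 total≤ v)
      where
      open ≤-Reasoning
      total≤ : sumFin (λ v → count v w + single v) ≤ sumFin {suc m} (λ _ → 2)
      total≤ = begin
        sumFin (λ v → count v w + single v) ≡⟨ sumFin-+ (λ v → count v w) single ⟩
        sumFin (λ v → count v w) + #singles ≡⟨ cong (_+ #singles) (length≡sumFin-count w) ⟨
        length w + #singles                 ≤⟨ +-mono-≤ short #singles≤2 ⟩
        m + m + 2                           ≡⟨ 2[m+1]≡2m+2 ⟨
        suc m * 2                           ≡⟨ sumFin-const (suc m) 2 ⟨
        sumFin {suc m} (λ _ → 2) ∎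

    two-singles : ∀ d → ¬ (∀ v → count v w ≡ 1 → v ≡ d)
    two-singles d only-d = 1+n≰n (begin
      suc (m + m + 1)     ≡⟨ +-suc (m + m) 1 ⟨
      m + m + 2           ≡⟨ 2[m+1]≡2m+2 ⟨
      suc m * 2           ≤⟨ 2[m+1]≤length+#singles ⟩
      length w + #singles ≤⟨ +-mono-≤ short #singles≤1 ⟩
      m + m + 1           ∎)
      where
      open ≤-Reasoning
      at-d : ∀ v → single v ≤ indicator (d == v)
      at-d v with count v w ≡ᵇ 1 in c
      ... | false = z≤n
      ... | true rewrite only-d v (≡ᵇ⇒≡ _ _ (Equivalence.from T-≡ c)) | ==-refl d = s≤s z≤n
      #singles≤1 : #singles ≤ 1
      #singles≤1 = ≤-trans (sumFin-mono at-d) (≤-reflexive (sumFin-== d))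

module Renaming {a b : ℕ} (f : Fin a → Fin b) (f-== : ∀ x y → (f x == f y) ≡ (x == y)) where

  count-map : ∀ v w → count (f v) (map f w) ≡ count v w
  count-map v [] = refl
  count-map v (x ∷ w) rewrite f-== x v with x == v
  ... | true = cong suc (count-map v w)
  ... | false = count-map v w

  noRepeat-map : ∀ w → noRepeat (map f w) ≡ noRepeat w
  noRepeat-map [] = refl
  noRepeat-map (x ∷ []) = refl
  noRepeat-map (x ∷ y ∷ w) = cong₂ (λ a b → not a ∧ b) (f-== x y) (noRepeat-map (y ∷ w))

  onto-map : ∀ x y w → onto (f x) (f y) (map f w) ≡ map f (onto x y w)
  onto-map x y [] = refl
  onto-map x y (z ∷ w) rewrite f-== z x | f-== z y with (z == x) ∨ (z == y)
  ... | true = cong (f z ∷_) (onto-map x y w)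
  ... | false = onto-map x y w

  alternate-map : ∀ w x y → alternate (map f w) (f x) (f y) ≡ alternate w x y
  alternate-map w x y = trans (cong noRepeat (onto-map x y w)) (noRepeat-map (onto x y w))

inject₁-== : ∀ {n} (a b : Fin n) → (inject₁ a == inject₁ b) ≡ (a == b)
inject₁-== a b with a ≟ b
... | yes refl = ==-refl (inject₁ a)
... | no a≢b = ≢⇒==-false (a≢b ∘ FP.inject₁-injective)

top-==-inject₁ : ∀ {n} (b : Fin n) → (fromℕ n == inject₁ b) ≡ false
top-==-inject₁ b = ≢⇒==-false FP.fromℕ≢inject₁

inject₁-==-top : ∀ {n} (b : Fin n) → (inject₁ b == fromℕ n) ≡ false
inject₁-==-top b = ≢⇒==-false (FP.fromℕ≢inject₁ ∘ sym)

module Inject {n : ℕ} = Renaming {n} {suc n} inject₁ inject₁-==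

count-top-inject : ∀ {n} (w : List (Fin n)) → count (fromℕ n) (map inject₁ w) ≡ 0
count-top-inject [] = refl
count-top-inject (x ∷ w) rewrite inject₁-==-top x = count-top-inject w

dropTop : ∀ {n} → List (Fin (suc n)) → List (Fin n)
dropTop [] = []
dropTop (z ∷ w) with view z
... | ‵fromℕ = dropTop w
... | ‵inject₁ y = y ∷ dropTop w

dropTop-top : ∀ {n} w → dropTop (fromℕ n ∷ w) ≡ dropTop w
dropTop-top {n} w rewrite view-fromℕ n = refl

dropTop-inject : ∀ {n} (y : Fin n) w → dropTop (inject₁ y ∷ w) ≡ y ∷ dropTop w
dropTop-inject y w rewrite view-inject₁ y = refl

dropTop-map-inject : ∀ {n} (w : List (Fin n)) → dropTop (map inject₁ w) ≡ w
dropTop-map-inject [] = refl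
dropTop-map-inject (y ∷ w) = trans (dropTop-inject y (map inject₁ w)) (cong (y ∷_) (dropTop-map-inject w))

dropTop-++ : ∀ {n} (u w : List (Fin (suc n))) → dropTop (u ++ w) ≡ dropTop u ++ dropTop w
dropTop-++ [] w = refl
dropTop-++ (z ∷ u) w with view z
... | ‵fromℕ = dropTop-++ u w
... | ‵inject₁ y = cong (y ∷_) (dropTop-++ u w)

count-dropTop : ∀ {n} (y : Fin n) w → count y (dropTop w) ≡ count (inject₁ y) w
count-dropTop y [] = refl
count-dropTop y (z ∷ w) with view z
... | ‵fromℕ rewrite top-==-inject₁ y = count-dropTop y w
... | ‵inject₁ x rewrite inject₁-== x y with x == y
...   | true = cong suc (count-dropTop y w)
...   | false = count-dropTop y w

length-dropTop : ∀ {n} (w : List (Fin (suc n))) → length w ≡ length (dropTop w) + count (fromℕ n) w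
length-dropTop [] = refl
length-dropTop {n} (z ∷ w) with view z
... | ‵fromℕ rewrite ==-refl (fromℕ n) = trans (cong suc (length-dropTop w)) (sym (+-suc _ _))
... | ‵inject₁ x rewrite inject₁-==-top x = cong suc (length-dropTop w)

top-free⇒inject : ∀ {n} (w : List (Fin (suc n))) → count (fromℕ n) w ≡ 0 → w ≡ map inject₁ (dropTop w)
top-free⇒inject [] _ = refl
top-free⇒inject {n} (z ∷ w) h with view z
... | ‵fromℕ rewrite ==-refl (fromℕ n) = case h of λ ()
... | ‵inject₁ x rewrite inject₁-==-top x = cong (inject₁ x ∷_) (top-free⇒inject w h)

onto-dropTop : ∀ {n} (x y : Fin n) w → onto (inject₁ x) (inject₁ y) w ≡ map inject₁ (onto x y (dropTop w))
onto-dropTop x y [] = refl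
onto-dropTop x y (z ∷ w) with view z
... | ‵fromℕ rewrite top-==-inject₁ x | top-==-inject₁ y = onto-dropTop x y w
... | ‵inject₁ z′ rewrite inject₁-== z′ x | inject₁-== z′ y with (z′ == x) ∨ (z′ == y)
...   | true = cong (inject₁ z′ ∷_) (onto-dropTop x y w)
...   | false = onto-dropTop x y w

alternate-dropTop : ∀ {n} (w : List (Fin (suc n))) x y → alternate w (inject₁ x) (inject₁ y) ≡ alternate (dropTop w) x y
alternate-dropTop w x y = trans (cong noRepeat (onto-dropTop x y w)) (Inject.noRepeat-map (onto x y (dropTop w)))

path-inject : ∀ m (x y : Fin (suc m)) → path (suc (suc m)) (inject₁ x) (inject₁ y) ≡ path (suc m) x y
path-inject m x y rewrite FP.toℕ-inject₁ x | FP.toℕ-inject₁ y = refl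

dropTop-Repr : ∀ {m} (w : List (Fin (suc (suc m)))) → Repr (path (suc (suc m))) w → Repr (path (suc m)) (dropTop w)
dropTop-Repr {m} w r = record
  { occurs = λ v → subst (1 ≤_) (sym (count-dropTop v w)) (occurs r (inject₁ v))
  ; edges = λ x y x≢y → begin
      path (suc m) x y                                 ≡⟨ path-inject m x y ⟨
      path (suc (suc m)) (inject₁ x) (inject₁ y)       ≡⟨ edges r (inject₁ x) (inject₁ y) (x≢y ∘ FP.inject₁-injective) ⟩
      alternate w (inject₁ x) (inject₁ y)              ≡⟨ alternate-dropTop w x y ⟩
      alternate (dropTop w) x y ∎ }
  where open ≡-Reasoning

module Wrap (m : ℕ) where

  e : Fin (suc (suc m))
  e = fromℕ (suc m)

  d : Fin (suc m)
  d = fromℕ m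

  d′ : Fin (suc (suc m))
  d′ = inject₁ d

  wrapped : List (Fin (suc m)) → List (Fin (suc m)) → List (Fin (suc (suc m)))
  wrapped α β = map inject₁ α ++ e ∷ d′ ∷ e ∷ map inject₁ β

  wrapWhere : (Fin (suc m) → List (Fin (suc m)) → Bool) → List (Fin (suc m)) → List (Fin (suc (suc m)))
  wrapWhere chosen [] = []
  wrapWhere chosen (x ∷ xs) =
    if chosen x xs then e ∷ inject₁ x ∷ e ∷ map inject₁ xs else inject₁ x ∷ wrapWhere chosen xs

  firstD lastD : Fin (suc m) → List (Fin (suc m)) → Bool
  firstD x _ = x == d
  lastD x xs = (x == d) ∧ (count d xs ≡ᵇ 0)

  wrapFirst wrapLast : List (Fin (suc m)) → List (Fin (suc (suc m)))
  wrapFirst = wrapWhere firstD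
  wrapLast = wrapWhere lastD

  count-d-around : ∀ α β → count d (α ++ d ∷ β) ≡ suc (count d α + count d β)
  count-d-around α β = trans (count-++ d α (d ∷ β)) (trans (cong (count d α +_) (count-here d β)) (+-suc _ _))

  wrapFirst-wraps : ∀ α β → count d α ≡ 0 → wrapFirst (α ++ d ∷ β) ≡ wrapped α β
  wrapFirst-wraps [] β _ rewrite ==-refl d = refl
  wrapFirst-wraps (x ∷ α) β h with x ≟ d
  wrapFirst-wraps (x ∷ α) β () | yes refl
  ... | no _ = cong (inject₁ x ∷_) (wrapFirst-wraps α β h)

  wrapLast-wraps : ∀ α β → count d β ≡ 0 → wrapLast (α ++ d ∷ β) ≡ wrapped α β
  wrapLast-wraps [] β h rewrite ==-refl d | h = refl
  wrapLast-wraps (x ∷ α) β h with x == d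
  ... | true rewrite count-d-around α β = cong (inject₁ x ∷_) (wrapLast-wraps α β h)
  ... | false = cong (inject₁ x ∷_) (wrapLast-wraps α β h)

  dropTop-wrapWhere : ∀ chosen u → dropTop (wrapWhere chosen u) ≡ u
  dropTop-wrapWhere chosen [] = refl
  dropTop-wrapWhere chosen (x ∷ xs) with chosen x xs
  ... | true = trans (dropTop-top _) (trans (dropTop-inject x _)
                 (cong (x ∷_) (trans (dropTop-top _) (dropTop-map-inject xs))))
  ... | false = trans (dropTop-inject x _) (cong (x ∷_) (dropTop-wrapWhere chosen xs))

  dropTop-wrapped : ∀ α β → dropTop (wrapped α β) ≡ α ++ d ∷ β
  dropTop-wrapped α β = trans (dropTop-++ (map inject₁ α) (e ∷ d′ ∷ e ∷ map inject₁ β))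
    (cong₂ _++_ (dropTop-map-inject α)
      (trans (dropTop-top _) (trans (dropTop-inject d _) (cong (d ∷_) (trans (dropTop-top _) (dropTop-map-inject β))))))

  count-e-wrapped : ∀ α β → count e (wrapped α β) ≡ 2
  count-e-wrapped α β rewrite count-++ e (map inject₁ α) (e ∷ d′ ∷ e ∷ map inject₁ β)
    | count-top-inject α | ==-refl e | inject₁-==-top d | count-top-inject β = refl

  length-wrapped : ∀ α β → length (wrapped α β) ≡ 2 + length (α ++ d ∷ β)
  length-wrapped α β rewrite length-++ (map inject₁ α) {e ∷ d′ ∷ e ∷ map inject₁ β}
    | length-map inject₁ α | length-map inject₁ β | length-++ α {d ∷ β}
    | +-suc (length α) (suc (suc (length β))) | +-suc (length α) (suc (length β)) = refl

  toℕ-d′ : toℕ d′ ≡ m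
  toℕ-d′ = trans (FP.toℕ-inject₁ d) (FP.toℕ-fromℕ m)

  e-adj-d′ : Adj e d′
  e-adj-d′ = inj₂ (trans (cong suc toℕ-d′) (sym (FP.toℕ-fromℕ (suc m))))

  e-neighbour : ∀ y → Adj e y → y ≡ d′
  e-neighbour y (inj₁ e+1≡y) =
    ⊥-elim (<-irrefl (sym (trans (cong suc (sym (FP.toℕ-fromℕ (suc m)))) e+1≡y)) (FP.toℕ<n y))
  e-neighbour y (inj₂ y+1≡e) = FP.toℕ-injective (trans (suc-injective (trans y+1≡e (FP.toℕ-fromℕ (suc m)))) (sym toℕ-d′))

  module _ (α β : List (Fin (suc m))) where

    alternate-e-wrapped : ∀ y → alternate (wrapped α β) e (inject₁ y)
      ≡ noRepeat (shape e (inject₁ y) (count y α) (count (inject₁ y) (d′ ∷ [])) (count y β))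
    alternate-e-wrapped y = cong noRepeat (begin
      onto e (inject₁ y) (wrapped α β)
        ≡⟨ onto-twice e (inject₁ y) (map inject₁ α) (d′ ∷ []) (map inject₁ β)
             (count-top-inject α) (count-top-inject (d ∷ [])) (count-top-inject β) ⟩
      shape e (inject₁ y) (count (inject₁ y) (map inject₁ α)) (count (inject₁ y) (d′ ∷ [])) (count (inject₁ y) (map inject₁ β))
        ≡⟨ cong₂ (λ a b → shape e (inject₁ y) a (count (inject₁ y) (d′ ∷ [])) b) (Inject.count-map y α) (Inject.count-map y β) ⟩
      shape e (inject₁ y) (count y α) (count (inject₁ y) (d′ ∷ [])) (count y β) ∎)
      where open ≡-Reasoning

    e-edges : count d (α ++ d ∷ β) ≤ 2 → ∀ y → path (suc (suc m)) e (inject₁ y) ≡ alternate (wrapped α β) e (inject₁ y)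
    e-edges d≤2 y with y ≟ d
    ... | yes refl = trans (Adj⇒path e d′ e-adj-d′) (sym (trans (alternate-e-wrapped d)
            (subst (λ c → noRepeat (shape e d′ (count d α) c (count d β)) ≡ true) (sym (count-here d′ []))
              (shape-alternates FP.fromℕ≢inject₁ (count d α) (count d β) (m+n≤o⇒m≤o _ outside≤1) (m+n≤o⇒n≤o _ outside≤1)))))
      where
      outside≤1 : count d α + count d β ≤ 1
      outside≤1 = ≤-pred (≤-trans (≤-reflexive (sym (count-d-around α β))) d≤2)
    ... | no y≢d = trans (¬Adj⇒¬path e (inject₁ y) (λ a → y≢d (FP.inject₁-injective (e-neighbour _ a))))
                     (sym (¬-not not-alternating))
      where
      not-alternating : alternate (wrapped α β) e (inject₁ y) ≢ true
      not-alternating alt with shape-alternates⇒one-between (count y α) _ (count y β) (trans (sym (alternate-e-wrapped y)) alt)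
      ... | one rewrite count-there {x = d′} [] (y≢d ∘ sym ∘ FP.inject₁-injective) = case one of λ ()

    wrapped-Repr : Repr (path (suc m)) (α ++ d ∷ β) → count d (α ++ d ∷ β) ≤ 2 → Repr (path (suc (suc m))) (wrapped α β)
    wrapped-Repr r d≤2 = record { occurs = occ ; edges = edge }
      where
      w : List (Fin (suc (suc m)))
      w = wrapped α β
      occ : ∀ v → 1 ≤ count v w
      occ v with view v
      ... | ‵fromℕ = subst (1 ≤_) (sym (count-e-wrapped α β)) (s≤s z≤n)
      ... | ‵inject₁ y = subst (1 ≤_) (trans (cong (count y) (sym (dropTop-wrapped α β))) (count-dropTop y w)) (occurs r y)
      edge : ∀ x y → x ≢ y → path (suc (suc m)) x y ≡ alternate w x y
      edge x y x≢y with view x | view y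
      ... | ‵fromℕ | ‵fromℕ = ⊥-elim (x≢y refl)
      ... | ‵fromℕ | ‵inject₁ y′ = e-edges d≤2 y′
      ... | ‵inject₁ x′ | ‵fromℕ = trans (path-sym _ (inject₁ x′) e) (trans (e-edges d≤2 x′) (alternate-sym w e (inject₁ x′)))
      ... | ‵inject₁ x′ | ‵inject₁ y′ = begin
        path (suc (suc m)) (inject₁ x′) (inject₁ y′) ≡⟨ path-inject m x′ y′ ⟩
        path (suc m) x′ y′                            ≡⟨ edges r x′ y′ (x≢y ∘ cong inject₁) ⟩
        alternate (α ++ d ∷ β) x′ y′                  ≡⟨ cong (λ u → alternate u x′ y′) (dropTop-wrapped α β) ⟨
        alternate (dropTop w) x′ y′                   ≡⟨ alternate-dropTop w x′ y′ ⟨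
        alternate w (inject₁ x′) (inject₁ y′) ∎
        where open ≡-Reasoning

-- Letters y below
-- d′ occur 0 or 2 times between the e's (once would make y alternate with e);
-- "absent between the e's" spreads along edges among these letters, and a
-- single letter below d′ is absent there, hence all of them are.

module Tightness (m : ℕ) (w : List (Fin (suc (suc m)))) (r : Repr (path (suc (suc m))) w)
    (count≤2 : ∀ v → count v w ≤ 2) (two-singles : ∀ c → ¬ (∀ v → count v w ≡ 1 → v ≡ c))
    (count-e : count (fromℕ (suc m)) w ≡ 2) where
  open Wrap m using (e; d; d′; wrapped; toℕ-d′; e-adj-d′; e-neighbour)

  Low : Fin (suc (suc m)) → Set
  Low y = toℕ y < m

  low⇒≢e : ∀ {y} → Low y → y ≢ e
  low⇒≢e {y} y<m refl = <-irrefl refl (≤-trans (n≤1+n (suc m)) (subst (_< m) (FP.toℕ-fromℕ (suc m)) y<m))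

  low⇒≢d′ : ∀ {y} → Low y → y ≢ d′
  low⇒≢d′ y<m refl = <-irrefl refl (subst (_< m) toℕ-d′ y<m)

  ≢d′,e⇒low : ∀ y → y ≢ d′ → y ≢ e → Low y
  ≢d′,e⇒low y y≢d′ y≢e = ≤∧≢⇒< (≤-pred (≤∧≢⇒< (≤-pred (FP.toℕ<n y))
      (λ y≡m+1 → y≢e (FP.toℕ-injective (trans y≡m+1 (sym (FP.toℕ-fromℕ (suc m))))))))
      (λ y≡m → y≢d′ (FP.toℕ-injective (trans y≡m (sym toℕ-d′))))

  letter : ∀ j → j < m → Fin (suc (suc m))
  letter j j<m = fromℕ< (≤-trans j<m (≤-trans (n≤1+n m) (n≤1+n (suc m))))

  toℕ-letter : ∀ j (j<m : j < m) → toℕ (letter j j<m) ≡ j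
  toℕ-letter j j<m = FP.toℕ-fromℕ< _

  module Factors (α γ β : List (Fin (suc (suc m)))) (w≡ : w ≡ α ++ e ∷ γ ++ e ∷ β)
                 (eα : count e α ≡ 0) (eγ : count e γ ≡ 0) (eβ : count e β ≡ 0) where

    count-w : ∀ y → y ≢ e → count y w ≡ count y α + (count y γ + count y β)
    count-w y y≢e = trans (cong (count y) w≡) (count-around₂ y e α γ β y≢e)

    count-γ≤ : ∀ y → y ≢ e → count y γ ≤ count y w
    count-γ≤ y y≢e = ≤-trans (m≤m+n (count y γ) (count y β))
                       (≤-trans (m≤n+m _ (count y α)) (≤-reflexive (sym (count-w y y≢e))))

    alternate-e : ∀ y → alternate w e y ≡ noRepeat (shape e y (count y α) (count y γ) (count y β))
    alternate-e y = cong noRepeat (trans (cong (onto e y) w≡) (onto-twice e y α γ β eα eγ eβ))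

    d′-between : count d′ γ ≡ 1
    d′-between = shape-alternates⇒one-between (count d′ α) _ (count d′ β)
      (trans (sym (alternate-e d′)) (trans (sym (edges r e d′ FP.fromℕ≢inject₁)) (Adj⇒path e d′ e-adj-d′)))

    outside+between≤2 : ∀ y → y ≢ e → count y α + count y β + count y γ ≤ 2
    outside+between≤2 y y≢e = begin
      count y α + count y β + count y γ   ≡⟨ +-assoc (count y α) (count y β) (count y γ) ⟩
      count y α + (count y β + count y γ) ≡⟨ cong (count y α +_) (+-comm (count y β) (count y γ)) ⟩
      count y α + (count y γ + count y β) ≡⟨ count-w y y≢e ⟨
      count y w                           ≤⟨ count≤2 y ⟩
      2 ∎
      where open ≤-Reasoning

    once-between⇒outside≤1 : ∀ y → y ≢ e → count y γ ≡ 1 → count y α + count y β ≤ 1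
    once-between⇒outside≤1 y y≢e once =
      +-cancelʳ-≤ 1 _ 1 (subst (λ c → count y α + count y β + c ≤ 2) once (outside+between≤2 y y≢e))

    twice-between⇒outside≡0 : ∀ y → y ≢ e → count y γ ≡ 2 → count y α + count y β ≡ 0
    twice-between⇒outside≡0 y y≢e twice =
      n≤0⇒n≡0 (+-cancelʳ-≤ 2 _ 0 (subst (λ c → count y α + count y β + c ≤ 2) twice (outside+between≤2 y y≢e)))

    -- A letter occurring once between the e's would alternate with e.
    low-not-once : ∀ y → Low y → count y γ ≢ 1
    low-not-once y y<m once = low⇒≢d′ y<m (e-neighbour y (path⇒Adj e y (begin
      path (suc (suc m)) e y ≡⟨ edges r e y (y≢e ∘ sym) ⟩
      alternate w e y         ≡⟨ alternate-e y ⟩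
      noRepeat (shape e y (count y α) (count y γ) (count y β))
        ≡⟨ cong (λ c → noRepeat (shape e y (count y α) c (count y β))) once ⟩
      noRepeat (shape e y (count y α) 1 (count y β))
        ≡⟨ shape-alternates (y≢e ∘ sym) (count y α) (count y β) (m+n≤o⇒m≤o _ outside≤1) (m+n≤o⇒n≤o _ outside≤1) ⟩
      true ∎)))
      where
      open ≡-Reasoning
      y≢e : y ≢ e
      y≢e = low⇒≢e y<m
      outside≤1 : count y α + count y β ≤ 1
      outside≤1 = once-between⇒outside≤1 y y≢e once

    low-absent-or-twice : ∀ y → Low y → count y γ ≢ 0 → count y γ ≡ 2
    low-absent-or-twice y y<m c≢0 with count y γ | low-not-once y y<m | count-γ≤ y (low⇒≢e y<m)
    ... | zero | _ | _ = ⊥-elim (c≢0 refl)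
    ... | suc zero | c≢1 | _ = ⊥-elim (c≢1 refl)
    ... | suc (suc zero) | _ | _ = refl
    ... | suc (suc (suc c)) | _ | c≤ = ⊥-elim (1+n≰n (≤-trans (≤-trans (s≤s (s≤s (s≤s z≤n))) c≤) (count≤2 y)))

    -- If y′ occurs twice between the e's, each neighbour y of y′ alternates with
    -- it and so occurs between the two y′'s, in particular between the e's.
    twice-between⇒neighbour-between : ∀ y y′ → y′ ≢ e → y′ ≢ y → Adj y′ y → count y′ γ ≡ 2 → count y γ ≢ 0
    twice-between⇒neighbour-between y y′ y′≢e y′≢y adj twice absent with split-twice y′ γ twice
    ... | γ₁ , γ₂ , γ₃ , γ≡ , y′γ₁ , y′γ₂ , y′γ₃ = case trans (sym one-in-γ₂) absent-in-γ₂ of λ ()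
      where
      y′-outside : count y′ α ≡ 0 × count y′ β ≡ 0
      y′-outside = m+n≡0⇒m≡0 _ αβ≡0 , m+n≡0⇒n≡0 _ αβ≡0
        where
        αβ≡0 : count y′ α + count y′ β ≡ 0
        αβ≡0 = twice-between⇒outside≡0 y′ y′≢e twice
      w≡′ : w ≡ (α ++ e ∷ γ₁) ++ y′ ∷ γ₂ ++ y′ ∷ (γ₃ ++ e ∷ β)
      w≡′ = trans w≡ (trans (cong (λ g → α ++ e ∷ g ++ e ∷ β) γ≡)
        (trans (cong (λ g → α ++ e ∷ g) (trans (++-assoc γ₁ (y′ ∷ γ₂ ++ y′ ∷ γ₃) (e ∷ β))
                                              (cong (λ g → γ₁ ++ y′ ∷ g) (++-assoc γ₂ (y′ ∷ γ₃) (e ∷ β)))))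
          (sym (++-assoc α (e ∷ γ₁) (y′ ∷ γ₂ ++ y′ ∷ (γ₃ ++ e ∷ β))))))
      y′-left : count y′ (α ++ e ∷ γ₁) ≡ 0
      y′-left = trans (count-around y′ e α γ₁ y′≢e) (cong₂ _+_ (proj₁ y′-outside) y′γ₁)
      y′-right : count y′ (γ₃ ++ e ∷ β) ≡ 0
      y′-right = trans (count-around y′ e γ₃ β y′≢e) (cong₂ _+_ y′γ₃ (proj₂ y′-outside))
      one-in-γ₂ : count y γ₂ ≡ 1
      one-in-γ₂ = shape-alternates⇒one-between (count y (α ++ e ∷ γ₁)) _ (count y (γ₃ ++ e ∷ β)) (begin
        noRepeat (shape y′ y (count y (α ++ e ∷ γ₁)) (count y γ₂) (count y (γ₃ ++ e ∷ β)))
          ≡⟨ cong noRepeat (onto-twice y′ y (α ++ e ∷ γ₁) γ₂ (γ₃ ++ e ∷ β) y′-left y′γ₂ y′-right) ⟨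
        alternate ((α ++ e ∷ γ₁) ++ y′ ∷ γ₂ ++ y′ ∷ (γ₃ ++ e ∷ β)) y′ y ≡⟨ cong (λ u → alternate u y′ y) w≡′ ⟨
        alternate w y′ y  ≡⟨ edges r y′ y y′≢y ⟨
        path (suc (suc m)) y′ y ≡⟨ Adj⇒path y′ y adj ⟩
        true ∎)
        where open ≡-Reasoning
      absent-in-γ₂ : count y γ₂ ≡ 0
      absent-in-γ₂ = m+n≡0⇒m≡0 (count y γ₂) (m+n≡0⇒n≡0 (count y γ₁)
        (trans (sym (trans (cong (count y) γ≡) (count-around₂ y y′ γ₁ γ₂ γ₃ (y′≢y ∘ sym)))) absent))

    absent-spreads : ∀ y y′ → Low y′ → Adj y′ y → count y γ ≡ 0 → count y′ γ ≡ 0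
    absent-spreads y y′ y′<m adj absent with count y′ γ ℕ.≟ 0
    ... | yes y′-absent = y′-absent
    ... | no y′-present = ⊥-elim (twice-between⇒neighbour-between y y′ (low⇒≢e y′<m) y′≢y adj
                                    (low-absent-or-twice y′ y′<m y′-present) absent)
      where
      y′≢y : y′ ≢ y
      y′≢y refl = [ 1+n≢n , 1+n≢n ]′ adj

    AbsentAt : ℕ → Set
    AbsentAt j = ∀ y → toℕ y ≡ j → count y γ ≡ 0

    absent-up : ∀ j → suc j < m → AbsentAt j → AbsentAt (suc j)
    absent-up j j+1<m absent y′ y′≡j+1 = absent-spreads y y′ (subst (_< m) (sym y′≡j+1) j+1<m)
      (inj₂ (trans (cong suc (toℕ-letter j j<m)) (sym y′≡j+1))) (absent y (toℕ-letter j j<m))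
      where
      j<m : j < m
      j<m = <-trans (n<1+n j) j+1<m
      y : Fin (suc (suc m))
      y = letter j j<m

    absent-down : ∀ j → suc j < m → AbsentAt (suc j) → AbsentAt j
    absent-down j j+1<m absent y′ y′≡j = absent-spreads y y′ (subst (_< m) (sym y′≡j) (<-trans (n<1+n j) j+1<m))
      (inj₁ (trans (cong suc y′≡j) (sym (toℕ-letter (suc j) j+1<m)))) (absent y (toℕ-letter (suc j) j+1<m))
      where
      y : Fin (suc (suc m))
      y = letter (suc j) j+1<m

    absent-to-0 : ∀ j → j < m → AbsentAt j → AbsentAt 0
    absent-to-0 zero _ absent = absent
    absent-to-0 (suc j) j+1<m absent = absent-to-0 j (<-trans (n<1+n j) j+1<m) (absent-down j j+1<m absent)

    absent-from-0 : ∀ j → j < m → AbsentAt 0 → AbsentAt j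
    absent-from-0 zero _ absent = absent
    absent-from-0 (suc j) j+1<m absent = absent-up j j+1<m (absent-from-0 j (<-trans (n<1+n j) j+1<m) absent)

    -- Some low letter is single, hence absent between the e's, hence all are.
    low-absent : ∀ y → Low y → count y γ ≡ 0
    low-absent y y<m with FP.any? (λ v → (count v w ℕ.≟ 1) ×-dec ¬? (v ≟ d′))
    ... | no no-other-single = ⊥-elim (two-singles d′ only-d′)
      where
      only-d′ : ∀ v → count v w ≡ 1 → v ≡ d′
      only-d′ v once with v ≟ d′
      ... | yes v≡d′ = v≡d′
      ... | no v≢d′ = ⊥-elim (no-other-single (v , once , v≢d′))
    ... | yes (v , once , v≢d′) = absent-from-0 (toℕ y) y<m (absent-to-0 (toℕ v) v<m v-absent) y refl
      where
      v≢e : v ≢ e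
      v≢e refl = case trans (sym count-e) once of λ ()
      v<m : Low v
      v<m = ≢d′,e⇒low v v≢d′ v≢e
      v-absent-between : count v γ ≡ 0
      v-absent-between with count v γ | low-not-once v v<m | count-γ≤ v v≢e
      ... | zero | _ | _ = refl
      ... | suc zero | not-once | _ = ⊥-elim (not-once refl)
      ... | suc (suc _) | _ | c≤ = ⊥-elim (1+n≰n (≤-trans (s≤s (s≤s z≤n)) (≤-trans c≤ (≤-reflexive once))))
      v-absent : AbsentAt (toℕ v)
      v-absent v′ v′≡v = subst (λ z → count z γ ≡ 0) (sym (FP.toℕ-injective v′≡v)) v-absent-between

    between≡d′ : γ ≡ d′ ∷ []
    between≡d′ = only-once⇒singleton d′ γ others-absent d′-between
      where
      others-absent : ∀ y → y ≢ d′ → count y γ ≡ 0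
      others-absent y y≢d′ with y ≟ e
      ... | yes refl = eγ
      ... | no y≢e = low-absent y (≢d′,e⇒low y y≢d′ y≢e)

  top-twice⇒wrapped : Σ[ α ∈ List (Fin (suc m)) ] Σ[ β ∈ List (Fin (suc m)) ] w ≡ wrapped α β
  top-twice⇒wrapped with split-twice e w count-e
  ... | α , γ , β , w≡ , eα , eγ , eβ = dropTop α , dropTop β , (begin
    w                                                          ≡⟨ w≡ ⟩
    α ++ e ∷ γ ++ e ∷ β                                        ≡⟨ cong (λ g → α ++ e ∷ g ++ e ∷ β) (Factors.between≡d′ α γ β w≡ eα eγ eβ) ⟩
    α ++ e ∷ d′ ∷ e ∷ β                                        ≡⟨ cong₂ (λ a b → a ++ e ∷ d′ ∷ e ∷ b) (top-free⇒inject α eα) (top-free⇒inject β eβ) ⟩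
    wrapped (dropTop α) (dropTop β) ∎)
    where open ≡-Reasoning

∧-intro : ∀ {a b} → T a → T b → T (a ∧ b)
∧-intro ta tb = Equivalence.from T-∧ (ta , tb)

∧-fst : ∀ {a b} → T (a ∧ b) → T a
∧-fst t = proj₁ (Equivalence.to T-∧ t)

∧-snd : ∀ {a b} → T (a ∧ b) → T b
∧-snd {a} t = proj₂ (Equivalence.to (T-∧ {a}) t)

T-not⇒¬T : ∀ {b} → T (not b) → ¬ T b
T-not⇒¬T {false} _ ()

Sub : ∀ {A : Set} → (A → Bool) → Set
Sub {A} p = Σ A (T ∘ p)

Sub-≡ : ∀ {A : Set} {p : A → Bool} {a a′ : A} {t : T (p a)} {t′ : T (p a′)} → a ≡ a′ → _≡_ {A = Sub p} (a , t) (a′ , t′)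
Sub-≡ refl = cong (_ ,_) (T-irrelevant _ _)

Sub-↔ : ∀ {A B : Set} (p : A → Bool) (p′ : B → Bool) (f : A → B) (g : B → A) →
  (∀ a → T (p a) → T (p′ (f a))) → (∀ b → T (p′ b) → T (p (g b))) →
  (∀ a → T (p a) → g (f a) ≡ a) → (∀ b → T (p′ b) → f (g b) ≡ b) → Sub p ↔ Sub p′
Sub-↔ p p′ f g f-ok g-ok gf fg = mk↔ₛ′
  (λ (a , t) → f a , f-ok a t) (λ (b , t) → g b , g-ok b t)
  (λ (b , t) → Sub-≡ (fg b t)) (λ (a , t) → Sub-≡ (gf a t))

Sub-cong : ∀ {A : Set} {p p′ : A → Bool} → (∀ a → p a ≡ p′ a) → Sub p ↔ Sub p′
Sub-cong p≗p′ = Sub-↔ _ _ (λ a → a) (λ a → a) (λ a → subst T (p≗p′ a)) (λ a → subst T (sym (p≗p′ a)))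
  (λ _ _ → refl) (λ _ _ → refl)

Sub-empty : ∀ {A : Set} (p : A → Bool) → (∀ a → ¬ T (p a)) → Fin 0 ↔ Sub p
Sub-empty p none = mk↔ₛ′ (λ ()) (λ (a , t) → ⊥-elim (none a t)) (λ (a , t) → ⊥-elim (none a t)) (λ ())

Sub-split : ∀ {A : Set} (p c : A → Bool) → Sub p ↔ (Sub (λ a → p a ∧ c a) ⊎ Sub (λ a → p a ∧ not (c a)))
Sub-split {A} p c = mk↔ₛ′ to from to-from from-to
  where
  Parts : Set
  Parts = Sub (λ a → p a ∧ c a) ⊎ Sub (λ a → p a ∧ not (c a))
  sort : (a : A) → T (p a) → (b : Bool) → c a ≡ b → Parts
  sort a t true ca = inj₁ (a , ∧-intro t (subst T (sym ca) tt))
  sort a t false ca = inj₂ (a , ∧-intro t (subst T (cong not (sym ca)) tt))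
  to : Sub p → Parts
  to (a , t) = sort a t (c a) refl
  from : Parts → Sub p
  from (inj₁ (a , t)) = a , ∧-fst t
  from (inj₂ (a , t)) = a , ∧-fst t
  sort-in₁ : ∀ a (t : T (p a ∧ c a)) t′ b (ca : c a ≡ b) → sort a t′ b ca ≡ inj₁ (a , t)
  sort-in₁ a t t′ true ca = cong inj₁ (Sub-≡ refl)
  sort-in₁ a t t′ false ca = ⊥-elim (subst T ca (∧-snd {p a} t))
  sort-in₂ : ∀ a (t : T (p a ∧ not (c a))) t′ b (ca : c a ≡ b) → sort a t′ b ca ≡ inj₂ (a , t)
  sort-in₂ a t t′ true ca = ⊥-elim (subst T (cong not ca) (∧-snd {p a} t))
  sort-in₂ a t t′ false ca = cong inj₂ (Sub-≡ refl)
  to-from : ∀ x → to (from x) ≡ x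
  to-from (inj₁ (a , t)) = sort-in₁ a t _ (c a) refl
  to-from (inj₂ (a , t)) = sort-in₂ a t _ (c a) refl
  from-sort : ∀ a (t : T (p a)) b (ca : c a ≡ b) → from (sort a t b ca) ≡ (a , t)
  from-sort a t true _ = Sub-≡ refl
  from-sort a t false _ = Sub-≡ refl
  from-to : ∀ x → from (to x) ≡ x
  from-to (a , t) = from-sort a t (c a) refl

minimal : (m : ℕ) → List (Fin (suc m)) → Bool
minimal m w = (length w ≡ᵇ m + m) ∧ representsᵇ (path (suc m)) w

topOnce zeroOnce : (m : ℕ) → List (Fin (suc m)) → Bool
topOnce m w = count (fromℕ m) w ≡ᵇ 1
zeroOnce m w = count zero w ≡ᵇ 1

OnceTop TwiceTop : (m : ℕ) → (List (Fin (suc m)) → Bool) → Set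
OnceTop m q = Sub (λ w → (minimal m w ∧ topOnce m w) ∧ q w)
TwiceTop m q = Sub (λ w → (minimal m w ∧ not (topOnce m w)) ∧ q w)

module _ {m : ℕ} (w : List (Fin (suc m))) where

  minimal-length : T (minimal m w) → length w ≡ m + m
  minimal-length t = ≡ᵇ⇒≡ _ _ (∧-fst t)

  minimal-Repr : T (minimal m w) → Repr (path (suc m)) w
  minimal-Repr t = Represents⇒Repr _ w (∧-snd {length w ≡ᵇ m + m} t)

  minimal-intro : length w ≡ m + m → Repr (path (suc m)) w → T (minimal m w)
  minimal-intro len r = ∧-intro (≡⇒≡ᵇ _ _ len) (Repr⇒Represents _ w r)

  minimal-count≤2 : T (minimal m w) → ∀ v → count v w ≤ 2
  minimal-count≤2 t = Singles.Minimal.count≤2 w (minimal-Repr t) (≤-reflexive (minimal-length t))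

  minimal-two-singles : T (minimal m w) → ∀ c → ¬ (∀ v → count v w ≡ 1 → v ≡ c)
  minimal-two-singles t = Singles.Minimal.two-singles w (minimal-Repr t) (≤-reflexive (minimal-length t))

  minimal-not-once⇒twice : T (minimal m w) → ∀ v → T (not (count v w ≡ᵇ 1)) → count v w ≡ 2
  minimal-not-once⇒twice t v not-once with count v w | occurs (minimal-Repr t) v | minimal-count≤2 t v
  ... | suc zero | _ | _ = ⊥-elim not-once
  ... | suc (suc zero) | _ | _ = refl
  ... | suc (suc (suc _)) | _ | s≤s (s≤s ())

-- Used to see that when the wrapped d is not the first of two, it is the last.
m+n≡1∧m≢0⇒n≡0 : ∀ m {n} → m + n ≡ 1 → m ≢ 0 → n ≡ 0
m+n≡1∧m≢0⇒n≡0 zero _ m≢0 = ⊥-elim (m≢0 refl)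
m+n≡1∧m≢0⇒n≡0 (suc zero) m+n≡1 _ = suc-injective m+n≡1
m+n≡1∧m≢0⇒n≡0 (suc (suc m)) ()

-- Deleting the top letter e maps the minimal words over
-- 0,…,m+1 with e twice onto the minimal words over 0,…,m, and each small word
-- is hit once for every occurrence of d in it (d occurs once or twice).

module Step (m : ℕ) (q : List (Fin (suc m)) → Bool) where
  open Wrap m

  big : List (Fin (suc (suc m))) → Bool
  big w = (minimal (suc m) w ∧ not (topOnce (suc m) w)) ∧ q (dropTop w)

  small : (List (Fin (suc m)) → Bool) → List (Fin (suc m)) → Bool
  small c u = (minimal m u ∧ c u) ∧ q u

  2[m+1]≡2m+2 : suc m + suc m ≡ 2 + (m + m)
  2[m+1]≡2m+2 = lemma m
    where
    lemma : ∀ m → suc m + suc m ≡ 2 + (m + m)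
    lemma = solve-∀

  module Big (w : List (Fin (suc (suc m)))) (t : T (big w)) where

    minimal-w : T (minimal (suc m) w)
    minimal-w = ∧-fst (∧-fst t)

    count-e : count e w ≡ 2
    count-e = minimal-not-once⇒twice w minimal-w e (∧-snd {minimal (suc m) w} (∧-fst t))

    unwrapped : Σ[ α ∈ List (Fin (suc m)) ] Σ[ β ∈ List (Fin (suc m)) ] w ≡ wrapped α β
    unwrapped = Tightness.top-twice⇒wrapped m w (minimal-Repr w minimal-w) (minimal-count≤2 w minimal-w)
                  (minimal-two-singles w minimal-w) count-e

    minimal-dropTop : T (minimal m (dropTop w))
    minimal-dropTop = minimal-intro (dropTop w) (+-cancelʳ-≡ 2 _ _ (begin
      length (dropTop w) + 2           ≡⟨ cong (length (dropTop w) +_) count-e ⟨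
      length (dropTop w) + count e w   ≡⟨ length-dropTop w ⟨
      length w                         ≡⟨ minimal-length w minimal-w ⟩
      suc m + suc m                    ≡⟨ 2[m+1]≡2m+2 ⟩
      2 + (m + m)                      ≡⟨ +-comm 2 (m + m) ⟩
      m + m + 2 ∎)) (dropTop-Repr w (minimal-Repr w minimal-w))
      where open ≡-Reasoning

  dropTop-small : ∀ c w → T (big w) → T (c (dropTop w)) → T (small c (dropTop w))
  dropTop-small c w t ct = ∧-intro (∧-intro (Big.minimal-dropTop w t) ct) (∧-snd {minimal (suc m) w ∧ not (topOnce (suc m) w)} t)

  wrap-big : ∀ chosen u α β → u ≡ α ++ d ∷ β → wrapWhere chosen u ≡ wrapped α β →
             T (minimal m u) → T (q u) → T (big (wrapWhere chosen u))
  wrap-big chosen u α β refl wrap≡ min qu = subst (T ∘ big) (sym wrap≡)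
    (∧-intro (∧-intro minimal-wrapped e-twice) (subst (T ∘ q) (sym (dropTop-wrapped α β)) qu))
    where
    minimal-wrapped : T (minimal (suc m) (wrapped α β))
    minimal-wrapped = minimal-intro (wrapped α β)
      (trans (length-wrapped α β) (trans (cong (2 +_) (minimal-length (α ++ d ∷ β) min)) (sym 2[m+1]≡2m+2)))
      (wrapped-Repr α β (minimal-Repr (α ++ d ∷ β) min) (minimal-count≤2 (α ++ d ∷ β) min d))
    e-twice : T (not (topOnce (suc m) (wrapped α β)))
    e-twice = subst (λ c → T (not (c ≡ᵇ 1))) (sym (count-e-wrapped α β)) tt

  wrap-small : ∀ c chosen u → T (small c u) → ∀ α β → u ≡ α ++ d ∷ β → wrapWhere chosen u ≡ wrapped α β →
               T (big (wrapWhere chosen u) ∧ c (dropTop (wrapWhere chosen u)))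
  wrap-small c chosen u t α β u≡ wrap≡ = ∧-intro
    (wrap-big chosen u α β u≡ wrap≡ (∧-fst {minimal m u} (∧-fst t)) (∧-snd {minimal m u ∧ c u} t))
    (subst (T ∘ c) (sym (dropTop-wrapWhere chosen u)) (∧-snd {minimal m u} (∧-fst t)))

  rewrap : ∀ chosen w → T (big w) →
           (∀ α β → w ≡ wrapped α β → wrapWhere chosen (α ++ d ∷ β) ≡ wrapped α β) → wrapWhere chosen (dropTop w) ≡ w
  rewrap chosen w t picks-right = rewrap-at (Big.unwrapped w t)
    where
    open ≡-Reasoning
    rewrap-at : (Σ[ α ∈ List (Fin (suc m)) ] Σ[ β ∈ List (Fin (suc m)) ] w ≡ wrapped α β) → wrapWhere chosen (dropTop w) ≡ w
    rewrap-at (α , β , w≡) = begin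
      wrapWhere chosen (dropTop w)             ≡⟨ cong (wrapWhere chosen ∘ dropTop) w≡ ⟩
      wrapWhere chosen (dropTop (wrapped α β)) ≡⟨ cong (wrapWhere chosen) (dropTop-wrapped α β) ⟩
      wrapWhere chosen (α ++ d ∷ β)            ≡⟨ picks-right α β w≡ ⟩
      wrapped α β                              ≡⟨ w≡ ⟨
      w ∎

  -- Whether the wrapped d is the first d: no d occurs before the first e.
  beforeTop : List (Fin (suc (suc m))) → List (Fin (suc (suc m)))
  beforeTop [] = []
  beforeTop (x ∷ xs) = if x == e then [] else x ∷ beforeTop xs

  firstWrapped : List (Fin (suc (suc m))) → Bool
  firstWrapped w = count d′ (beforeTop w) ≡ᵇ 0

  firstWrapped-wrapped : ∀ α β → firstWrapped (wrapped α β) ≡ (count d α ≡ᵇ 0)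
  firstWrapped-wrapped α β = cong (_≡ᵇ 0) (trans (cong (count d′) (beforeTop-wrapped α)) (Inject.count-map d α))
    where
    beforeTop-wrapped : ∀ α → beforeTop (wrapped α β) ≡ map inject₁ α
    beforeTop-wrapped [] rewrite ==-refl e = refl
    beforeTop-wrapped (x ∷ α) rewrite inject₁-==-top x = cong (inject₁ x ∷_) (beforeTop-wrapped α)

  bigOnce bigTwice bigFirst bigLast : List (Fin (suc (suc m))) → Bool
  bigOnce w = big w ∧ topOnce m (dropTop w)
  bigTwice w = big w ∧ not (topOnce m (dropTop w))
  bigFirst w = bigTwice w ∧ firstWrapped w
  bigLast w = bigTwice w ∧ not (firstWrapped w)

  count-d-twice : ∀ w → T (bigTwice w) → count d (dropTop w) ≡ 2
  count-d-twice w t = minimal-not-once⇒twice (dropTop w) (Big.minimal-dropTop w (∧-fst t)) d (∧-snd {big w} t)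

  wrapOnce-↔ : Sub bigOnce ↔ Sub (small (topOnce m))
  wrapOnce-↔ = Sub-↔ bigOnce (small (topOnce m)) dropTop wrapFirst
    (λ w t → dropTop-small (topOnce m) w (∧-fst t) (∧-snd {big w} t))
    wrap-ok
    (λ w t → rewrap firstD w (∧-fst t) (first-is-wrapped w t))
    (λ u _ → dropTop-wrapWhere firstD u)
    where
    wrap-ok : ∀ u → T (small (topOnce m) u) → T (bigOnce (wrapFirst u))
    wrap-ok u t = wrap-at (split-once d u (≡ᵇ⇒≡ _ _ (∧-snd {minimal m u} (∧-fst t))))
      where
      wrap-at : OnceSplit d u → T (bigOnce (wrapFirst u))
      wrap-at (α , β , u≡ , dα , _) =
        wrap-small (topOnce m) firstD u t α β u≡ (trans (cong wrapFirst u≡) (wrapFirst-wraps α β dα))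
    first-is-wrapped : ∀ w → T (bigOnce w) → ∀ α β → w ≡ wrapped α β → wrapFirst (α ++ d ∷ β) ≡ wrapped α β
    first-is-wrapped w t α β refl = wrapFirst-wraps α β (m+n≡0⇒m≡0 _ (suc-injective (begin
      suc (count d α + count d β)        ≡⟨ count-d-around α β ⟨
      count d (α ++ d ∷ β)               ≡⟨ cong (count d) (dropTop-wrapped α β) ⟨
      count d (dropTop (wrapped α β))    ≡⟨ ≡ᵇ⇒≡ _ _ (∧-snd {big (wrapped α β)} t) ⟩
      1 ∎)))
      where open ≡-Reasoning

  wrapFirst-↔ : Sub bigFirst ↔ Sub (small (not ∘ topOnce m))
  wrapFirst-↔ = Sub-↔ bigFirst (small (not ∘ topOnce m)) dropTop wrapFirst
    (λ w t → dropTop-small (not ∘ topOnce m) w (∧-fst (∧-fst t)) (∧-snd {big w} (∧-fst t)))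
    wrap-ok
    (λ w t → rewrap firstD w (∧-fst (∧-fst t)) (first-is-wrapped w t))
    (λ u _ → dropTop-wrapWhere firstD u)
    where
    wrap-ok : ∀ u → T (small (not ∘ topOnce m) u) → T (bigFirst (wrapFirst u))
    wrap-ok u t = wrap-at (split-twice d u (minimal-not-once⇒twice u (∧-fst (∧-fst t)) d (∧-snd {minimal m u} (∧-fst t))))
      where
      wrap-at : TwiceSplit d u → T (bigFirst (wrapFirst u))
      wrap-at (α , γ , β , u≡ , dα , _ , _) = ∧-intro twice
        (subst (T ∘ firstWrapped) (sym wrapped≡) (subst T (sym (firstWrapped-wrapped α (γ ++ d ∷ β))) (≡⇒≡ᵇ _ _ dα)))
        where
        wrapped≡ : wrapFirst u ≡ wrapped α (γ ++ d ∷ β)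
        wrapped≡ = trans (cong wrapFirst u≡) (wrapFirst-wraps α (γ ++ d ∷ β) dα)
        twice : T (bigTwice (wrapFirst u))
        twice = wrap-small (not ∘ topOnce m) firstD u t α (γ ++ d ∷ β) u≡ wrapped≡
    first-is-wrapped : ∀ w → T (bigFirst w) → ∀ α β → w ≡ wrapped α β → wrapFirst (α ++ d ∷ β) ≡ wrapped α β
    first-is-wrapped w t α β refl =
      wrapFirst-wraps α β (≡ᵇ⇒≡ _ _ (subst T (firstWrapped-wrapped α β) (∧-snd {bigTwice (wrapped α β)} t)))

  wrapLast-↔ : Sub bigLast ↔ Sub (small (not ∘ topOnce m))
  wrapLast-↔ = Sub-↔ bigLast (small (not ∘ topOnce m)) dropTop wrapLast
    (λ w t → dropTop-small (not ∘ topOnce m) w (∧-fst (∧-fst t)) (∧-snd {big w} (∧-fst t)))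
    wrap-ok
    (λ w t → rewrap lastD w (∧-fst (∧-fst t)) (last-is-wrapped w t))
    (λ u _ → dropTop-wrapWhere lastD u)
    where
    wrap-ok : ∀ u → T (small (not ∘ topOnce m) u) → T (bigLast (wrapLast u))
    wrap-ok u t = wrap-at (split-twice d u (minimal-not-once⇒twice u (∧-fst (∧-fst t)) d (∧-snd {minimal m u} (∧-fst t))))
      where
      wrap-at : TwiceSplit d u → T (bigLast (wrapLast u))
      wrap-at (α , γ , β , u≡ , _ , _ , dβ) = ∧-intro twice
        (subst (T ∘ not ∘ firstWrapped) (sym wrapped≡)
          (subst (T ∘ not) (sym (trans (firstWrapped-wrapped (α ++ d ∷ γ) β) (cong (_≡ᵇ 0) (count-d-around α γ)))) tt))
        where
        u≡′ : u ≡ (α ++ d ∷ γ) ++ d ∷ β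
        u≡′ = trans u≡ (sym (++-assoc α (d ∷ γ) (d ∷ β)))
        wrapped≡ : wrapLast u ≡ wrapped (α ++ d ∷ γ) β
        wrapped≡ = trans (cong wrapLast u≡′) (wrapLast-wraps (α ++ d ∷ γ) β dβ)
        twice : T (bigTwice (wrapLast u))
        twice = wrap-small (not ∘ topOnce m) lastD u t (α ++ d ∷ γ) β u≡′ wrapped≡
    last-is-wrapped : ∀ w → T (bigLast w) → ∀ α β → w ≡ wrapped α β → wrapLast (α ++ d ∷ β) ≡ wrapped α β
    last-is-wrapped w t α β refl = wrapLast-wraps α β d-not-after
      where
      d-around : count d α + count d β ≡ 1
      d-around = suc-injective (trans (sym (trans (cong (count d) (dropTop-wrapped α β)) (count-d-around α β)))
                                      (count-d-twice (wrapped α β) (∧-fst t)))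
      d-before : count d α ≢ 0
      d-before dα = T-not⇒¬T (subst (T ∘ not) (firstWrapped-wrapped α β) (∧-snd {bigTwice (wrapped α β)} t)) (≡⇒≡ᵇ _ _ dα)
      d-not-after : count d β ≡ 0
      d-not-after = m+n≡1∧m≢0⇒n≡0 (count d α) d-around d-before

  step-↔ : TwiceTop (suc m) (q ∘ dropTop) ↔ (OnceTop m q ⊎ (TwiceTop m q ⊎ TwiceTop m q))
  step-↔ = ↔-trans (Sub-split big (topOnce m ∘ dropTop))
           (wrapOnce-↔ ⊎-cong ↔-trans (Sub-split bigTwice firstWrapped) (wrapFirst-↔ ⊎-cong wrapLast-↔))

opposite-injective : ∀ {n} {a b : Fin n} → opposite a ≡ opposite b → a ≡ b
opposite-injective {a = a} {b} eq =
  trans (sym (FP.opposite-involutive a)) (trans (cong opposite eq) (FP.opposite-involutive b))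

opposite-== : ∀ {n} (a b : Fin n) → (opposite a == opposite b) ≡ (a == b)
opposite-== a b with a ≟ b
... | yes refl = ==-refl _
... | no a≢b = ≢⇒==-false (a≢b ∘ opposite-injective)

module Opposite {n : ℕ} = Renaming {n} {n} opposite opposite-==

map-opposite-involutive : ∀ {n} (w : List (Fin n)) → map opposite (map opposite w) ≡ w
map-opposite-involutive [] = refl
map-opposite-involutive (x ∷ w) = cong₂ _∷_ (FP.opposite-involutive x) (map-opposite-involutive w)

reflect-consecutive : ∀ m a b → a ≤ m → suc b ≡ a → suc (m ∸ a) ≡ m ∸ b
reflect-consecutive m a b a≤m b+1≡a = +-cancelʳ-≡ b _ _ (begin
  suc (m ∸ a) + b ≡⟨ +-suc (m ∸ a) b ⟨
  m ∸ a + suc b   ≡⟨ cong (m ∸ a +_) b+1≡a ⟩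
  m ∸ a + a       ≡⟨ m∸n+n≡m a≤m ⟩
  m               ≡⟨ m∸n+n≡m (≤-trans (n≤1+n b) (subst (_≤ m) (sym b+1≡a) a≤m)) ⟨
  m ∸ b + b ∎)
  where open ≡-Reasoning

opposite-Adj : ∀ {m} (x y : Fin (suc m)) → Adj x y → Adj (opposite x) (opposite y)
opposite-Adj {m} x y adj rewrite FP.opposite-prop x | FP.opposite-prop y with adj
... | inj₁ x+1≡y = inj₂ (reflect-consecutive m (toℕ y) (toℕ x) (≤-pred (FP.toℕ<n y)) x+1≡y)
... | inj₂ y+1≡x = inj₁ (reflect-consecutive m (toℕ x) (toℕ y) (≤-pred (FP.toℕ<n x)) y+1≡x)

path-opposite : ∀ m (x y : Fin (suc m)) → path (suc m) (opposite x) (opposite y) ≡ path (suc m) x y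
path-opposite m x y with path (suc m) x y in xy
... | true = Adj⇒path _ _ (opposite-Adj x y (path⇒Adj x y xy))
... | false = ¬Adj⇒¬path _ _ (λ adj → case trans (sym xy) (Adj⇒path x y (reflect-back adj)) of λ ())
  where
  reflect-back : Adj (opposite x) (opposite y) → Adj x y
  reflect-back adj = subst₂ Adj (FP.opposite-involutive x) (FP.opposite-involutive y) (opposite-Adj _ _ adj)

opposite-Repr : ∀ m w → Repr (path (suc m)) w → Repr (path (suc m)) (map opposite w)
opposite-Repr m w r = record { occurs = occ ; edges = edge }
  where
  occ : ∀ v → 1 ≤ count v (map opposite w)
  occ v = subst (λ z → 1 ≤ count z (map opposite w)) (FP.opposite-involutive v)
            (subst (1 ≤_) (sym (Opposite.count-map (opposite v) w)) (occurs r (opposite v)))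
  edge : ∀ x y → x ≢ y → path (suc m) x y ≡ alternate (map opposite w) x y
  edge x y x≢y = begin
    path (suc m) x y
      ≡⟨ cong₂ (path (suc m)) (FP.opposite-involutive x) (FP.opposite-involutive y) ⟨
    path (suc m) (opposite (opposite x)) (opposite (opposite y))
      ≡⟨ path-opposite m (opposite x) (opposite y) ⟩
    path (suc m) (opposite x) (opposite y)
      ≡⟨ edges r (opposite x) (opposite y) (x≢y ∘ opposite-injective) ⟩
    alternate w (opposite x) (opposite y)
      ≡⟨ Opposite.alternate-map w (opposite x) (opposite y) ⟨
    alternate (map opposite w) (opposite (opposite x)) (opposite (opposite y))
      ≡⟨ cong₂ (alternate (map opposite w)) (FP.opposite-involutive x) (FP.opposite-involutive y) ⟩
    alternate (map opposite w) x y ∎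
    where open ≡-Reasoning

opposite-minimal : ∀ m w → T (minimal m w) → T (minimal m (map opposite w))
opposite-minimal m w t = minimal-intro (map opposite w) (trans (length-map opposite w) (minimal-length w t))
  (opposite-Repr m w (minimal-Repr w t))

topOnce↔zeroOnce : ∀ m → OnceTop m (λ _ → true) ↔ Sub (λ w → minimal m w ∧ zeroOnce m w)
topOnce↔zeroOnce m = Sub-↔ _ _ (map opposite) (map opposite) reverse-ok reverse-back-ok
  (λ w _ → map-opposite-involutive w) (λ w _ → map-opposite-involutive w)
  where
  top↔zero : ∀ w → count zero (map opposite w) ≡ count (fromℕ m) w
  top↔zero w = trans (cong (λ z → count z (map opposite w)) (sym (FP.opposite-involutive zero)))
                     (Opposite.count-map (fromℕ m) w)
  reverse-ok : ∀ w → T ((minimal m w ∧ topOnce m w) ∧ true) → T (minimal m (map opposite w) ∧ zeroOnce m (map opposite w))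
  reverse-ok w t = ∧-intro (opposite-minimal m w (∧-fst (∧-fst t)))
    (subst (λ c → T (c ≡ᵇ 1)) (sym (top↔zero w)) (∧-snd {minimal m w} (∧-fst t)))
  reverse-back-ok : ∀ w → T (minimal m w ∧ zeroOnce m w) → T ((minimal m (map opposite w) ∧ topOnce m (map opposite w)) ∧ true)
  reverse-back-ok w t = ∧-intro (∧-intro (opposite-minimal m w (∧-fst t))
    (subst (λ c → T (c ≡ᵇ 1)) (sym (Opposite.count-map zero w)) (∧-snd {minimal m w} t))) tt

anyWord : ∀ {m} → List (Fin (suc m)) → Bool
anyWord _ = true

minimal-split : ∀ m → Sub (minimal m) ↔ (OnceTop m anyWord ⊎ TwiceTop m anyWord)
minimal-split m = ↔-trans (Sub-split (minimal m) (topOnce m))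
  (Sub-cong (λ w → sym (∧-identityʳ (minimal m w ∧ topOnce m w)))
   ⊎-cong Sub-cong (λ w → sym (∧-identityʳ (minimal m w ∧ not (topOnce m w)))))

zeroOnce-split : ∀ m → Sub (λ w → minimal m w ∧ zeroOnce m w) ↔ (OnceTop m (zeroOnce m) ⊎ TwiceTop m (zeroOnce m))
zeroOnce-split m = ↔-trans (Sub-split (λ w → minimal m w ∧ zeroOnce m w) (topOnce m))
  (Sub-cong (λ w → swap₂₃ (minimal m w) (zeroOnce m w) (topOnce m w))
   ⊎-cong Sub-cong (λ w → swap₂₃ (minimal m w) (zeroOnce m w) (not (topOnce m w))))
  where
  swap₂₃ : ∀ a b c → (a ∧ b) ∧ c ≡ (a ∧ c) ∧ b
  swap₂₃ true b c = ∧-comm b c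
  swap₂₃ false b c = refl

-- For m ≥ 2 the letters 0 and m are not adjacent, so they are never both single.
zero-and-top-not-both-once : ∀ m w → ¬ T ((minimal (suc (suc m)) w ∧ topOnce (suc (suc m)) w) ∧ zeroOnce (suc (suc m)) w)
zero-and-top-not-both-once m w t with path⇒Adj zero top (trans (edges r zero top (λ ())) (singles-alternate w zero top (λ ()) zero-once top-once))
  where
  top : Fin (suc (suc (suc m)))
  top = fromℕ (suc (suc m))
  r : Repr (path (suc (suc (suc m)))) w
  r = minimal-Repr w (∧-fst (∧-fst t))
  zero-once : count zero w ≡ 1
  zero-once = ≡ᵇ⇒≡ _ _ (∧-snd {minimal (suc (suc m)) w ∧ _} t)
  top-once : count top w ≡ 1
  top-once = ≡ᵇ⇒≡ _ _ (∧-snd {minimal (suc (suc m)) w} (∧-fst t))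
... | inj₁ 1≡top = case trans 1≡top (FP.toℕ-fromℕ (suc (suc m))) of λ ()
... | inj₂ ()

base-once : (q : List (Fin 2) → Bool) → T (q (zero ∷ suc zero ∷ [])) → T (q (suc zero ∷ zero ∷ [])) → Fin 2 ↔ OnceTop 1 q
base-once q q01 q10 = mk↔ₛ′ to from to-from from-to
  where
  to : Fin 2 → OnceTop 1 q
  to zero = (zero ∷ suc zero ∷ []) , ∧-intro tt q01
  to (suc zero) = (suc zero ∷ zero ∷ []) , ∧-intro tt q10
  from : OnceTop 1 q → Fin 2
  from ((zero ∷ suc zero ∷ []) , _) = zero
  from ((suc zero ∷ zero ∷ []) , _) = suc zero
  from ([] , ())
  from ((_ ∷ []) , ())
  from ((zero ∷ zero ∷ []) , ())
  from ((suc zero ∷ suc zero ∷ []) , ())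
  from ((_ ∷ _ ∷ _ ∷ _) , ())
  to-from : ∀ w → to (from w) ≡ w
  to-from ((zero ∷ suc zero ∷ []) , _) = Sub-≡ refl
  to-from ((suc zero ∷ zero ∷ []) , _) = Sub-≡ refl
  to-from ([] , ())
  to-from ((_ ∷ []) , ())
  to-from ((zero ∷ zero ∷ []) , ())
  to-from ((suc zero ∷ suc zero ∷ []) , ())
  to-from ((_ ∷ _ ∷ _ ∷ _) , ())
  from-to : ∀ i → from (to i) ≡ i
  from-to zero = refl
  from-to (suc zero) = refl

base-twice : (q : List (Fin 2) → Bool) → Fin 0 ↔ TwiceTop 1 q
base-twice q = Sub-empty (λ w → (minimal 1 w ∧ not (topOnce 1 w)) ∧ q w) none
  where
  none : ∀ w → ¬ T ((minimal 1 w ∧ not (topOnce 1 w)) ∧ q w)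
  none [] ()
  none (_ ∷ []) ()
  none (zero ∷ zero ∷ []) ()
  none (zero ∷ suc zero ∷ []) ()
  none (suc zero ∷ zero ∷ []) ()
  none (suc zero ∷ suc zero ∷ []) ()
  none (_ ∷ _ ∷ _ ∷ _) ()

record Sizes (m once twice once₀ twice₀ : ℕ) : Set where
  field
    onceTop : Fin once ↔ OnceTop m anyWord
    twiceTop : Fin twice ↔ TwiceTop m anyWord
    onceTop₀ : Fin once₀ ↔ OnceTop m (zeroOnce m)
    twiceTop₀ : Fin twice₀ ↔ TwiceTop m (zeroOnce m)
open Sizes

sizes-base : Sizes 1 2 0 2 0
sizes-base = record { onceTop = base-once anyWord tt tt ; twiceTop = base-twice anyWord
                    ; onceTop₀ = base-once (zeroOnce 1) tt tt ; twiceTop₀ = base-twice (zeroOnce 1) }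

zeroOnce-dropTop : ∀ m w → zeroOnce m (dropTop w) ≡ zeroOnce (suc m) w
zeroOnce-dropTop m w = cong (_≡ᵇ 1) (count-dropTop zero w)

Fin-+³ : ∀ a b c → Fin (a + (b + c)) ↔ (Fin a ⊎ (Fin b ⊎ Fin c))
Fin-+³ a b c = ↔-trans (FP.+↔⊎ {a}) (↔-refl ⊎-cong FP.+↔⊎ {b})

-- The recurrence: the step bijection for the "twice" classes, reversal for the
-- "once" class, and emptiness of "top once and 0 once".
sizes-step : ∀ m {a b a₀ b₀} → Sizes (suc m) a b a₀ b₀ →
             Sizes (suc (suc m)) (a₀ + (b₀ + b₀)) (a + (b + b)) 0 (a₀ + (b₀ + b₀))
sizes-step m {a} {b} {a₀} {b₀} S = record
  { onceTop = ↔-trans (FP.+↔⊎ {0}) (↔-trans (none ⊎-cong twice₀)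
                (↔-trans (↔-sym (zeroOnce-split (suc (suc m)))) (↔-sym (topOnce↔zeroOnce (suc (suc m))))))
  ; twiceTop = ↔-trans (Fin-+³ a b b) (↔-trans (onceTop S ⊎-cong (twiceTop S ⊎-cong twiceTop S))
                 (↔-sym (Step.step-↔ (suc m) anyWord)))
  ; onceTop₀ = none
  ; twiceTop₀ = twice₀ }
  where
  none : Fin 0 ↔ OnceTop (suc (suc m)) (zeroOnce (suc (suc m)))
  none = Sub-empty (λ w → (minimal (suc (suc m)) w ∧ topOnce (suc (suc m)) w) ∧ zeroOnce (suc (suc m)) w)
           (zero-and-top-not-both-once m)
  twice₀ : Fin (a₀ + (b₀ + b₀)) ↔ TwiceTop (suc (suc m)) (zeroOnce (suc (suc m)))
  twice₀ = ↔-trans (Fin-+³ a₀ b₀ b₀) (↔-trans (onceTop₀ S ⊎-cong (twiceTop₀ S ⊎-cong twiceTop₀ S))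
             (↔-trans (↔-sym (Step.step-↔ (suc m) (zeroOnce (suc m))))
               (Sub-cong (λ w → cong ((minimal (suc (suc m)) w ∧ not (topOnce (suc (suc m)) w)) ∧_) (zeroOnce-dropTop (suc m) w)))))

resize : ∀ {m a b a₀ b₀ a′ b′ a₀′ b₀′} → a ≡ a′ → b ≡ b′ → a₀ ≡ a₀′ → b₀ ≡ b₀′ →
         Sizes m a b a₀ b₀ → Sizes m a′ b′ a₀′ b₀′
resize refl refl refl refl S = S

sizes : ∀ s → Sizes (suc (suc s)) (2 ^ suc s) ((s + 2) * 2 ^ s) 0 (2 ^ suc s)
sizes zero = sizes-step 0 sizes-base
sizes (suc s) = resize (doubling (2 ^ s)) (recurrence s (2 ^ s)) refl (doubling (2 ^ s)) (sizes-step (suc s) (sizes s))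
  where
  doubling : ∀ P → 0 + (2 * P + 2 * P) ≡ 2 * (2 * P)
  doubling = solve-∀
  recurrence : ∀ s P → 2 * P + ((s + 2) * P + (s + 2) * P) ≡ (suc s + 2) * (2 * P)
  recurrence = solve-∀

listToVec : ∀ {A : Set} (w : List A) {n} → length w ≡ n → Vec A n
listToVec [] {zero} _ = []v
listToVec (x ∷ w) {suc n} len = x ∷v listToVec w (suc-injective len)

toList-listToVec : ∀ {A : Set} (w : List A) {n} (len : length w ≡ n) → toList (listToVec w len) ≡ w
toList-listToVec [] {zero} _ = refl
toList-listToVec (x ∷ w) {suc n} len = cong (x ∷_) (toList-listToVec w (suc-injective len))

listToVec-toList : ∀ {A : Set} {n} (v : Vec A n) (len : length (toList v) ≡ n) → listToVec (toList v) len ≡ v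
listToVec-toList []v _ = refl
listToVec-toList (x ∷v v) len = cong (x ∷v_) (listToVec-toList v (suc-injective len))

minimal↔Vec : ∀ m → Sub (minimal m) ↔ Σ (Vec (Fin (suc m)) (m + m)) (λ v → Represents (path (suc m)) (toList v))
minimal↔Vec m = mk↔ₛ′ to from (λ (v , _) → Σ-≡,≡→≡ (listToVec-toList v _ , T-irrelevant _ _))
                                 (λ (w , _) → Sub-≡ (toList-listToVec w _))
  where
  to : Sub (minimal m) → Σ (Vec (Fin (suc m)) (m + m)) (λ v → Represents (path (suc m)) (toList v))
  to (w , t) = listToVec w (minimal-length w t) ,
               subst (Represents (path (suc m))) (sym (toList-listToVec w (minimal-length w t))) (∧-snd {length w ≡ᵇ m + m} t)
  from : Σ (Vec (Fin (suc m)) (m + m)) (λ v → Represents (path (suc m)) (toList v)) → Sub (minimal m)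
  from (v , t) = toList v , ∧-intro (≡⇒≡ᵇ _ _ (length-toList v)) t

total : ∀ s → 2 ^ suc s + (s + 2) * 2 ^ s ≡ (suc (suc (suc s)) + 1) * 2 ^ s
total s = lemma s (2 ^ s)
  where
  lemma : ∀ s P → 2 * P + (s + 2) * P ≡ (suc (suc (suc s)) + 1) * P
  lemma = solve-∀

corollary1 : (k : ℕ) → 3 ≤ k → IsNumMinWords (path k) ((k + 1) * 2 ^ (k ∸ 3))
corollary1 (suc (suc (suc s))) (s≤s (s≤s (s≤s _))) = m + m , (witness , length≥2m) , enumeration
  where
  m : ℕ
  m = suc (suc s)
  MinWords : Set
  MinWords = Σ (Vec (Fin (suc m)) (m + m)) (λ v → Represents (path (suc m)) (toList v))
  enumeration : Fin ((suc m + 1) * 2 ^ s) ↔ MinWords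
  enumeration = ↔-trans (subst (λ N → Fin N ↔ (Fin (2 ^ suc s) ⊎ Fin ((s + 2) * 2 ^ s))) (total s) (FP.+↔⊎ {2 ^ suc s}))
    (↔-trans (onceTop (sizes s) ⊎-cong twiceTop (sizes s)) (↔-trans (↔-sym (minimal-split m)) (minimal↔Vec m)))
  witness : MinWords
  witness = Inverse.to enumeration (fromℕ< (<-≤-trans (m^n>0 2 s) (m≤m+n (2 ^ s) _)))
  length≥2m : ∀ w → Represents (path (suc m)) w → m + m ≤ length w
  length≥2m w r = Singles.length≥2m w (Represents⇒Repr _ w r)
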